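{- Let $y\in\{213,231\}$. For every $n\ge 0$, the number of permutations of $\{1,\dots,n\}$ that avoid both $\omega$ and the classical pattern $y$ equals the $n$th Motzkin number $m_n$.
   Context: A permutation $p=p_1\cdots p_n$ avoids the classical pattern $y=y_1y_2y_3$ if there are no indices $i_1<i_2<i_3$ with $p_{i_s}<p_{i_t}\iff y_s<y_t$. A permutation $p$ avoids $\omega$ if there are no indices $i,j$ with $i+1<j$, $p_i>p_{i+1}$ and $p_{i+1}=p_j+1$. The Motzkin numbers $m_n$ are defined by the generating function $M(t)=\sum_{n\ge0}m_nt^n$ satisfying $M=1+tM+t^2M^2$ (so $m_0=m_1=1$, $m_2=2$, $m_3=4,\dots$). -}

module Defs where

open import Data.Nat using (ℕ; zero; suc; _+_; _*_)
open import Data.Fin using (Fin; toℕ; zero; suc) renaming (_<_ to _<ᶠ_)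
open import Data.Vec using (Vec; lookup; []; _∷_)
open import Data.List using (List; []; _∷_; concatMap; map; zipWith; reverse)
open import Data.Nat.ListAction using (sum)
open import Data.List as L using ()
open import Data.Product using (Σ; ∃; _×_; _,_)
open import Function.Bundles using (_⇔_)
open import Relation.Nullary using (¬_)
open import Relation.Binary.PropositionalEquality using (_≡_)
import Data.Nat as ℕ

-- A permutation of {1,…,n} in one-line notation, with values shifted to
-- {0,…,n-1} (Fin n): a word p = p₀ ⋯ p_{n-1} of length n with distinct letters.
Word : ℕ → Set
Word n = Vec (Fin n) n

IsPerm : {n : ℕ} → Word n → Set
IsPerm {n} p = (i j : Fin n) → lookup p i ≡ lookup p j → i ≡ j

vecs : {A : Set} → List A → (k : ℕ) → List (Vec A k)
vecs as zero    = [] ∷ []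
vecs as (suc k) = concatMap (λ a → map (a ∷_) (vecs as k)) as

allWords : (n : ℕ) → List (Word n)
allWords n = vecs (L.tabulate (λ i → i)) n

data CountIs {A : Set} (P : A → Set) : List A → ℕ → Set where
  c[]   : CountIs P [] 0
  cyes  : ∀ {x xs m} → P x → CountIs P xs m → CountIs P (x ∷ xs) (suc m)
  cno   : ∀ {x xs m} → ¬ P x → CountIs P xs m → CountIs P (x ∷ xs) m

-- Classical patterns of length 3, in one-line notation (values shifted by 1).
Pattern3 : Set
Pattern3 = Vec (Fin 3) 3

p213 : Pattern3
p213 = suc zero ∷ zero ∷ suc (suc zero) ∷ []

p231 : Pattern3
p231 = suc zero ∷ suc (suc zero) ∷ zero ∷ []

Contains3 : {n : ℕ} → Word n → Pattern3 → Set
Contains3 {n} p y =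
  Σ (Fin n) λ i₁ → Σ (Fin n) λ i₂ → Σ (Fin n) λ i₃ →
    (i₁ <ᶠ i₂) × (i₂ <ᶠ i₃) ×
    ((s t : Fin 3) →
      (lookup p (idx i₁ i₂ i₃ s) <ᶠ lookup p (idx i₁ i₂ i₃ t)) ⇔ (lookup y s <ᶠ lookup y t))
  where
  idx : Fin n → Fin n → Fin n → Fin 3 → Fin n
  idx a b c zero = a
  idx a b c (suc zero) = b
  idx a b c (suc (suc zero)) = c

Avoids3 : {n : ℕ} → Word n → Pattern3 → Set
Avoids3 p y = ¬ Contains3 p y

ContainsOmega : {n : ℕ} → Word n → Set
ContainsOmega {n} p =
  Σ (Fin n) λ i → Σ (Fin n) λ k → Σ (Fin n) λ j →
    (toℕ k ≡ suc (toℕ i)) × (toℕ k ℕ.< toℕ j) ×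
    (lookup p k <ᶠ lookup p i) × (toℕ (lookup p k) ≡ suc (toℕ (lookup p j)))

AvoidsOmega : {n : ℕ} → Word n → Set
AvoidsOmega p = ¬ ContainsOmega p

-- Motzkin numbers via the recurrence equivalent to M = 1 + tM + t²M²:
-- m₀ = 1, m_{n+1} = m_n + Σ_{k=0}^{n-1} m_k m_{n-1-k}.
-- motzkinsRev n = [m_n, m_{n-1}, …, m_0].
motzkinsRev : ℕ → List ℕ
motzkinsRev zero = 1 ∷ []
motzkinsRev (suc n) with motzkinsRev n
... | []     = 1 ∷ []
... | m ∷ ms = (m + sum (zipWith _*_ ms (reverse ms))) ∷ m ∷ ms

motzkin : ℕ → ℕ
motzkin n with motzkinsRev n
... | []    = 0
... | m ∷ _ = m

-- Both classes are built by the Motzkin recurrence m_{n+1} = m_n + Σ_{a+b=n-1} m_a m_b (letters 0, …, n).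
-- Avoiding 231, every letter before the maximum n is smaller than every letter after it, so the prefix α is
-- a permutation of 0 … k-1 and the suffix of k … n-1. Avoiding ω, a nonempty suffix starts with its
-- minimum k: otherwise b - 1 comes after b and n b (b - 1) is an ω. Hence a member of size n + 1 is either
-- v n, or α n k β′ with β′ a shifted member; conversely all such words avoid both patterns.
-- Avoiding 213 the same happens around the minimum 0: the part after 0 lies below the part before it, and
-- avoiding ω forces the part before 0 to start with its own minimum. In both cases the decomposition is
-- unique, so the avoiders of size n + 1 correspond to those of size n plus pairs of avoiders of sizes a, b.

module Submission where

open import Data.Nat as ℕ using (ℕ; zero; suc; _+_; _*_; _∸_; _≤_; _<_; z≤n; s≤s; _≟_)
open import Data.Nat.Properties
open import Data.Nat.Induction using (<-rec)
open import Data.Nat.ListAction using (sum)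
open import Data.Fin as Fin using (Fin; toℕ; zero; suc)
import Data.Fin.Properties as FinP
open import Data.Vec using (Vec; []; _∷_; lookup)
open import Data.List as List
  using (List; []; _∷_; _++_; map; length; applyUpTo; upTo; downFrom; concat; concatMap; zipWith; reverse; filter)
open import Data.List.Properties
  using ( length-++; length-map; length-applyUpTo; map-injective; map-∘; map-id-local; ++-cancelʳ
        ; ∷-injectiveˡ; ∷-injectiveʳ; reverse-map; reverse-downFrom; ≡-dec)
open import Data.List.Relation.Unary.All as All using (All; []; _∷_)
open import Data.List.Relation.Unary.All.Properties.Core using (¬Any⇒All¬)
open import Data.List.Relation.Unary.Any as Any using (Any; here; there)
import Data.List.Relation.Unary.Any.Properties as Any
open import Data.List.Relation.Unary.AllPairs using ([]; _∷_)
open import Data.List.Relation.Unary.Unique.Propositional using (Unique)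
import Data.List.Relation.Unary.Unique.Propositional.Properties as Unique
open import Data.List.Relation.Binary.Subset.Propositional using (_⊆_)
open import Data.List.Membership.Propositional using (_∈_; _∉_; find)
open import Data.List.Membership.Propositional.Properties
open import Data.List.Membership.DecPropositional _≟_ using (_∈?_)
open import Data.List.Membership.DecPropositional (≡-dec _≟_) using () renaming (_∈?_ to _∈ᴸ?_)
open import Data.Product using (Σ; _×_; _,_; proj₁; proj₂; uncurry)
open import Data.Sum using (_⊎_; inj₁; inj₂)
import Data.Sum
open import Data.Empty using (⊥; ⊥-elim)
open import Data.Bool using (T)
open import Function using (id; _∘_)
open import Function.Bundles using (_⇔_; mk⇔; Equivalence)
open import Relation.Nullary using (¬_; yes; no)
open import Relation.Unary using (Decidable)
open import Relation.Binary.Definitions using (tri<; tri≈; tri>)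
open import Relation.Binary.PropositionalEquality

open import Defs

∈-++-skip : ∀ {A : Set} (xs : List A) {ys} {x y : A} → x ∈ xs ++ y ∷ ys → x ≢ y → x ∈ xs ++ ys
∈-++-skip []       (here x≡y) x≢y = ⊥-elim (x≢y x≡y)
∈-++-skip []       (there x∈) _   = x∈
∈-++-skip (_ ∷ xs) (here x≡z) _   = here x≡z
∈-++-skip (_ ∷ xs) (there x∈) x≢y = there (∈-++-skip xs x∈ x≢y)

unique-⊆⇒length≤ : ∀ {A : Set} {xs ys : List A} → Unique xs → xs ⊆ ys → length xs ≤ length ys
unique-⊆⇒length≤ {xs = []} _ _ = z≤n
unique-⊆⇒length≤ {xs = x ∷ xs} {ys} (x∉xs ∷ xs!) xs⊆ys with as , bs , refl ← ∈-∃++ (xs⊆ys (here refl)) =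
  begin
    suc (length xs)         ≤⟨ s≤s (unique-⊆⇒length≤ xs! xs⊆as++bs) ⟩
    suc (length (as ++ bs)) ≡⟨ cong suc (length-++ as) ⟩
    suc (length as + length bs) ≡⟨ +-suc (length as) (length bs) ⟨
    length as + length (x ∷ bs) ≡⟨ length-++ as ⟨
    length (as ++ x ∷ bs)   ∎
  where
  open ≤-Reasoning
  xs⊆as++bs : xs ⊆ as ++ bs
  xs⊆as++bs y∈ = ∈-++-skip as (xs⊆ys (there y∈)) λ y≡x → All.lookup x∉xs y∈ (sym y≡x)

unique-⊆-length≥⇒⊇ : {xs ys : List ℕ} → Unique xs → xs ⊆ ys → length ys ≤ length xs → ys ⊆ xs
unique-⊆-length≥⇒⊇ {xs} {ys} xs! xs⊆ys |ys|≤|xs| {y} y∈ys with y ∈? xs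
... | yes y∈xs = y∈xs
... | no  y∉xs = ⊥-elim (<⇒≱ (unique-⊆⇒length≤ (¬Any⇒All¬ xs y∉xs ∷ xs!) y∷xs⊆ys) |ys|≤|xs|)
  where
  y∷xs⊆ys : y ∷ xs ⊆ ys
  y∷xs⊆ys (here refl) = y∈ys
  y∷xs⊆ys (there z∈)  = xs⊆ys z∈

Unique-++⁻ : ∀ {A : Set} (xs : List A) {ys} → Unique (xs ++ ys) → Unique xs × Unique ys × (∀ {x} → x ∈ xs → x ∉ ys)
Unique-++⁻ []       ys!           = [] , ys! , λ ()
Unique-++⁻ (x ∷ xs) (x∉ ∷ xs++ys!) with xs! , ys! , disjoint ← Unique-++⁻ xs xs++ys! =
  All.tabulate (λ y∈ → All.lookup x∉ (∈-++⁺ˡ y∈)) ∷ xs! , ys! ,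
  λ { (here refl) y∈ys → All.lookup x∉ (∈-++⁺ʳ xs y∈ys) refl ; (there y∈) y∈ys → disjoint y∈ y∈ys }

++-∷-injective : ∀ {A : Set} {x : A} α α′ {t t′} → x ∉ α → x ∉ α′ → α ++ x ∷ t ≡ α′ ++ x ∷ t′ → α ≡ α′ × t ≡ t′
++-∷-injective []      []       _    _     refl = refl , refl
++-∷-injective []      (_ ∷ _)  _    x∉α′ refl = ⊥-elim (x∉α′ (here refl))
++-∷-injective (_ ∷ _) []       x∉α  _    refl = ⊥-elim (x∉α (here refl))
++-∷-injective (_ ∷ α) (_ ∷ α′) x∉α  x∉α′ eq
  with refl , t≡t′ ← ++-∷-injective α α′ (x∉α ∘ there) (x∉α′ ∘ there) (∷-injectiveʳ eq) =
  cong (_∷ α) (∷-injectiveˡ eq) , t≡t′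

index-of : ℕ → List ℕ → ℕ
index-of x []      = 0
index-of x (y ∷ l) with x ≟ y
... | yes _ = 0
... | no  _ = suc (index-of x l)

index-of-++-∷ : ∀ {x} α {t} → x ∉ α → index-of x (α ++ x ∷ t) ≡ length α
index-of-++-∷ {x} []      _   with x ≟ x
... | yes _   = refl
... | no  x≢x = ⊥-elim (x≢x refl)
index-of-++-∷ {x} (y ∷ α) x∉ with x ≟ y
... | yes refl = ⊥-elim (x∉ (here refl))
... | no  _    = cong suc (index-of-++-∷ α (x∉ ∘ there))

length-++-∷ : ∀ {A : Set} (α : List A) {x β} → length (α ++ x ∷ β) ≡ suc (length α + length β)
length-++-∷ α {x} {β} = trans (length-++ α) (+-suc (length α) (length β))

module _ {A B : Set} where

  Unique-map⁺ : ∀ {f : A → B} {xs} → (∀ {x y} → x ∈ xs → y ∈ xs → f x ≡ f y → x ≡ y) → Unique xs → Unique (map f xs)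
  Unique-map⁺ {xs = []}     _     []           = []
  Unique-map⁺ {f} {x ∷ xs} f-inj (x∉xs ∷ xs!) =
    All.tabulate (λ fy∈ fx≡fy → let y , y∈ , fy≡ = ∈-map⁻ f fy∈ in
                   All.lookup x∉xs y∈ (f-inj (here refl) (there y∈) (trans fx≡fy fy≡)))
    ∷ Unique-map⁺ (λ x∈ y∈ → f-inj (there x∈) (there y∈)) xs!

  Unique-concatMap⁺ : ∀ (f : A → List B) {xs} → Unique xs → (∀ {x} → x ∈ xs → Unique (f x)) →
                      (∀ {x y u} → x ∈ xs → y ∈ xs → u ∈ f x → u ∈ f y → x ≡ y) → Unique (concatMap f xs)
  Unique-concatMap⁺ f {[]}     _            _      _        = []
  Unique-concatMap⁺ f {x ∷ xs} (x∉xs ∷ xs!) fx-uniq separate =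
    Unique.++⁺ (fx-uniq (here refl))
               (Unique-concatMap⁺ f xs! (fx-uniq ∘ there) (λ x∈ y∈ → separate (there x∈) (there y∈)))
               λ (u∈fx , u∈rest) → let y , y∈ , u∈fy = find (∈-concatMap⁻ f {xs = xs} u∈rest) in
                 All.lookup x∉xs y∈ (separate (here refl) (there y∈) u∈fx u∈fy)

-- Lists enumerating an interval

range : ℕ → ℕ → List ℕ
range s m = applyUpTo (s +_) m

∈-range⁺ : ∀ {s m x} → s ≤ x → x < s + m → x ∈ range s m
∈-range⁺ {s} s≤x x<s+m with _ , refl ← m≤n⇒∃[o]m+o≡n s≤x = ∈-applyUpTo⁺ (s +_) (+-cancelˡ-< s _ _ x<s+m)

∈-range⁻ : ∀ {s m x} → x ∈ range s m → s ≤ x × x < s + m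
∈-range⁻ {s} x∈ with i , i<m , refl ← ∈-applyUpTo⁻ (s +_) x∈ = m≤m+n s i , +-monoʳ-< s i<m

range-unique : ∀ s m → Unique (range s m)
range-unique s m = Unique.applyUpTo⁺₁ (s +_) m λ i<j _ eq → <⇒≢ i<j (+-cancelˡ-≡ s _ _ eq)

record IsRange (s m : ℕ) (u : List ℕ) : Set where
  constructor isRange
  field
    unique  : Unique u
    bounded : ∀ {x} → x ∈ u → s ≤ x × x < s + m
    covers  : ∀ {x} → s ≤ x → x < s + m → x ∈ u
open IsRange public

IsRange-length : ∀ {s m u} → IsRange s m u → length u ≡ m
IsRange-length {s} {m} {u} r = ≤-antisym
  (subst (length u ≤_) (length-applyUpTo (s +_) m) (unique-⊆⇒length≤ (unique r) (uncurry ∈-range⁺ ∘ bounded r)))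
  (subst (_≤ length u) (length-applyUpTo (s +_) m) (unique-⊆⇒length≤ (range-unique s m) (uncurry (covers r) ∘ ∈-range⁻)))

IsRange-[] : ∀ {s} → IsRange s 0 []
IsRange-[] {s} = isRange [] (λ ()) λ s≤x x<s+0 → ⊥-elim (<⇒≱ x<s+0 (≤-trans (≤-reflexive (+-identityʳ s)) s≤x))

IsRange-∷ : ∀ {s m u} → IsRange (suc s) m u → IsRange s (suc m) (s ∷ u)
IsRange-∷ {s} {m} {u} r = isRange (All.tabulate (λ x∈ s≡x → <⇒≢ (proj₁ (bounded r x∈)) s≡x) ∷ unique r)
                                  bounded′ covers′
  where
  bounded′ : ∀ {x} → x ∈ s ∷ u → s ≤ x × x < s + suc m
  bounded′ (here refl)     = ≤-refl , m<m+n s (s≤s z≤n)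
  bounded′ {x} (there x∈) = <⇒≤ (proj₁ (bounded r x∈)) , subst (x <_) (sym (+-suc s m)) (proj₂ (bounded r x∈))
  covers′ : ∀ {x} → s ≤ x → x < s + suc m → x ∈ s ∷ u
  covers′ {x} s≤x x<s+1+m with s ≟ x
  ... | yes refl = here refl
  ... | no  s≢x  = there (covers r (≤∧≢⇒< s≤x s≢x) (subst (x <_) (+-suc s m) x<s+1+m))

module _ {s a b A B C} (rA : IsRange s a A) (rB : IsRange (s + a) b B) (C! : Unique C)
         (C⊆A∪B : ∀ {x} → x ∈ C → x ∈ A ⊎ x ∈ B) (A∪B⊆C : ∀ {x} → x ∈ A ⊎ x ∈ B → x ∈ C) where

  IsRange-union : IsRange s (a + b) C
  IsRange-union = isRange C! bounded′ covers′
    where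
    bounded′ : ∀ {x} → x ∈ C → s ≤ x × x < s + (a + b)
    bounded′ {x} x∈ with C⊆A∪B x∈
    ... | inj₁ x∈A = proj₁ (bounded rA x∈A) , <-≤-trans (proj₂ (bounded rA x∈A)) (+-monoʳ-≤ s (m≤m+n a b))
    ... | inj₂ x∈B = ≤-trans (m≤m+n s a) (proj₁ (bounded rB x∈B)) , subst (x <_) (+-assoc s a b) (proj₂ (bounded rB x∈B))
    covers′ : ∀ {x} → s ≤ x → x < s + (a + b) → x ∈ C
    covers′ {x} s≤x x<s+a+b with x <? s + a
    ... | yes x<s+a = A∪B⊆C (inj₁ (covers rA s≤x x<s+a))
    ... | no  x≮s+a = A∪B⊆C (inj₂ (covers rB (≮⇒≥ x≮s+a) (subst (x <_) (sym (+-assoc s a b)) x<s+a+b)))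

private
  consecutive-disjoint : ∀ {s a b A B} → IsRange s a A → IsRange (s + a) b B → ∀ {x} → x ∈ A → x ∉ B
  consecutive-disjoint rA rB x∈A x∈B = <⇒≱ (proj₂ (bounded rA x∈A)) (proj₁ (bounded rB x∈B))

IsRange-++ : ∀ {s a b A B} → IsRange s a A → IsRange (s + a) b B → IsRange s (a + b) (A ++ B)
IsRange-++ {A = A} rA rB = IsRange-union rA rB (Unique.++⁺ (unique rA) (unique rB) (λ (x∈A , x∈B) → consecutive-disjoint rA rB x∈A x∈B))
  (∈-++⁻ A) Data.Sum.[ ∈-++⁺ˡ , ∈-++⁺ʳ A ]

IsRange-++ᵒᵖ : ∀ {s a b A B} → IsRange s a A → IsRange (s + a) b B → IsRange s (a + b) (B ++ A)
IsRange-++ᵒᵖ {B = B} rA rB = IsRange-union rA rB (Unique.++⁺ (unique rB) (unique rA) (λ (x∈B , x∈A) → consecutive-disjoint rA rB x∈A x∈B))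
  (Data.Sum.swap ∘ ∈-++⁻ B) Data.Sum.[ ∈-++⁺ʳ B , ∈-++⁺ˡ ]

IsRange-∷⁻ : ∀ {s m u} → IsRange s (suc m) (s ∷ u) → IsRange (suc s) m u
IsRange-∷⁻ {s} {m} {u} r@(isRange (s∉u ∷ u!) _ _) = isRange u! bounded′ covers′
  where
  bounded′ : ∀ {x} → x ∈ u → suc s ≤ x × x < suc s + m
  bounded′ {x} x∈ with s≤x , x<s+1+m ← bounded r (there x∈) =
    ≤∧≢⇒< s≤x (λ s≡x → All.lookup s∉u x∈ s≡x) , subst (x <_) (+-suc s m) x<s+1+m
  covers′ : ∀ {x} → suc s ≤ x → x < suc s + m → x ∈ u
  covers′ {x} s<x x<1+s+m with covers r (<⇒≤ s<x) (subst (x <_) (sym (+-suc s m)) x<1+s+m)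
  ... | here x≡s  = ⊥-elim (<⇒≢ s<x (sym x≡s))
  ... | there x∈u = x∈u

shift : ℕ → List ℕ → List ℕ
shift s = map (_+ s)

shift-injective : ∀ s {w w′} → shift s w ≡ shift s w′ → w ≡ w′
shift-injective s = map-injective λ {x} {y} → +-cancelʳ-≡ s x y

0∉shift : ∀ k w → 0 ∉ shift (suc k) w
0∉shift k w 0∈ with x , _ , 0≡x+1+k ← ∈-map⁻ (_+ suc k) 0∈ with () ← trans 0≡x+1+k (+-suc x k)

IsRange-shift : ∀ {m w} s → IsRange 0 m w → IsRange s m (shift s w)
IsRange-shift {m} {w} s r = isRange (Unique.map⁺ (λ {x} {y} → +-cancelʳ-≡ s x y) (unique r)) bounded′ covers′
  where
  bounded′ : ∀ {x} → x ∈ shift s w → s ≤ x × x < s + m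
  bounded′ x∈ with y , y∈ , refl ← ∈-map⁻ (_+ s) x∈ =
    m≤n+m s y , subst (_< s + m) (+-comm s y) (+-monoʳ-< s (proj₂ (bounded r y∈)))
  covers′ : ∀ {x} → s ≤ x → x < s + m → x ∈ shift s w
  covers′ {x} s≤x x<s+m = subst (_∈ shift s w) (m∸n+n≡m s≤x)
    (∈-map⁺ (_+ s) (covers r z≤n (+-cancelˡ-< s _ _ (subst (_< s + m) (sym (m+[n∸m]≡n s≤x)) x<s+m))))

IsRange-unshift : ∀ {m w} s → IsRange s m w → Σ (List ℕ) λ w₀ → IsRange 0 m w₀ × shift s w₀ ≡ w
IsRange-unshift {m} {w} s r = map (_∸ s) w , isRange unique₀ bounded₀ covers₀ , shift-unshift
  where
  shift-unshift : shift s (map (_∸ s) w) ≡ w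
  shift-unshift = trans (sym (map-∘ w)) (map-id-local (All.tabulate λ x∈ → m∸n+n≡m (proj₁ (bounded r x∈))))
  unique₀ : Unique (map (_∸ s) w)
  unique₀ = Unique.map⁻ (subst Unique (sym shift-unshift) (unique r))
  bounded₀ : ∀ {x} → x ∈ map (_∸ s) w → 0 ≤ x × x < m
  bounded₀ x∈ with y , y∈ , refl ← ∈-map⁻ (_∸ s) x∈ with s≤y , y<s+m ← bounded r y∈ =
    z≤n , +-cancelˡ-< s _ _ (subst (_< s + m) (sym (m+[n∸m]≡n s≤y)) y<s+m)
  covers₀ : ∀ {x} → 0 ≤ x → x < m → x ∈ map (_∸ s) w
  covers₀ {x} _ x<m = subst (_∈ map (_∸ s) w) (m+n∸n≡m x s)
    (∈-map⁺ (_∸ s) (covers r (m≤n+m s x) (subst (_< s + m) (+-comm s x) (+-monoʳ-< s x<m))))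

module _ {s N : ℕ} {A B : List ℕ} (A! : Unique A) (B! : Unique B) (A∩B≡∅ : ∀ {x} → x ∈ A → x ∉ B)
         (bounded-A∪B : ∀ {x} → x ∈ A ⊎ x ∈ B → s ≤ x × x < s + N)
         (covers-A∪B : ∀ {x} → s ≤ x → x < s + N → x ∈ A ⊎ x ∈ B)
         (A<B : ∀ {x y} → x ∈ A → y ∈ B → x < y) where

  private
    k : ℕ
    k = length A

    ⊆range⇒length≤ : ∀ {t} → (∀ {x} → x ∈ A → x < s + t) → k ≤ t
    ⊆range⇒length≤ {t} A<s+t = ≤-trans
      (unique-⊆⇒length≤ A! λ x∈ → ∈-range⁺ (proj₁ (bounded-A∪B (inj₁ x∈))) (A<s+t x∈))
      (≤-reflexive (length-applyUpTo (s +_) t))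

    A-downward-closed : ∀ {x y} → x ∈ A → s ≤ y → y ≤ x → y ∈ A
    A-downward-closed x∈A s≤y y≤x with covers-A∪B s≤y (≤-<-trans y≤x (proj₂ (bounded-A∪B (inj₁ x∈A))))
    ... | inj₁ y∈A = y∈A
    ... | inj₂ y∈B = ⊥-elim (<⇒≱ (A<B x∈A y∈B) y≤x)

    A-bounded : ∀ {x} → x ∈ A → x < s + k
    A-bounded {x} x∈A with x <? s + k
    ... | yes x<s+k = x<s+k
    ... | no  x≮s+k = ⊥-elim (<⇒≱ (≤-trans (≤-reflexive (sym (length-applyUpTo (s +_) (suc k))))
                                           (unique-⊆⇒length≤ (range-unique s (suc k)) range⊆A)) ≤-refl)
      where
      range⊆A : range s (suc k) ⊆ A
      range⊆A {y} y∈ with s≤y , y<s+1+k ← ∈-range⁻ y∈ =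
        A-downward-closed x∈A s≤y (≤-trans (≤-pred (subst (y <_) (+-suc s k) y<s+1+k)) (≮⇒≥ x≮s+k))

    k≤N : k ≤ N
    k≤N = ⊆range⇒length≤ λ x∈ → proj₂ (bounded-A∪B (inj₁ x∈))

    A-covers : ∀ {y} → s ≤ y → y < s + k → y ∈ A
    A-covers {y} s≤y y<s+k with covers-A∪B s≤y (<-≤-trans y<s+k (+-monoʳ-≤ s k≤N))
    ... | inj₁ y∈A = y∈A
    ... | inj₂ y∈B with _ , refl ← m≤n⇒∃[o]m+o≡n s≤y =
      ⊥-elim (<⇒≱ (+-cancelˡ-< s _ _ y<s+k) (⊆range⇒length≤ λ x∈A → A<B x∈A y∈B))

  IsRange-split : IsRange s k A × IsRange (s + k) (N ∸ k) B
  IsRange-split = isRange A! (λ x∈ → proj₁ (bounded-A∪B (inj₁ x∈)) , A-bounded x∈) A-covers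
                , isRange B! B-bounded B-covers
    where
    s+k+[N∸k]≡s+N : s + k + (N ∸ k) ≡ s + N
    s+k+[N∸k]≡s+N = trans (+-assoc s k _) (cong (s +_) (m+[n∸m]≡n k≤N))
    B-bounded : ∀ {x} → x ∈ B → s + k ≤ x × x < s + k + (N ∸ k)
    B-bounded {x} x∈B with s≤x , x<s+N ← bounded-A∪B (inj₂ x∈B) with x <? s + k
    ... | yes x<s+k = ⊥-elim (A∩B≡∅ (A-covers s≤x x<s+k) x∈B)
    ... | no  x≮s+k = ≮⇒≥ x≮s+k , subst (x <_) (sym s+k+[N∸k]≡s+N) x<s+N
    B-covers : ∀ {x} → s + k ≤ x → x < s + k + (N ∸ k) → x ∈ B
    B-covers {x} s+k≤x x<_ with covers-A∪B (≤-trans (m≤m+n s k) s+k≤x) (subst (x <_) s+k+[N∸k]≡s+N x<_)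
    ... | inj₁ x∈A = ⊥-elim (<⇒≱ (A-bounded x∈A) s+k≤x)
    ... | inj₂ x∈B = x∈B

module CutAt {s m : ℕ} (α : List ℕ) {e : ℕ} {β : List ℕ} (r : IsRange s m (α ++ e ∷ β)) where

  private
    parts = Unique-++⁻ α (unique r)

  α! : Unique α
  α! = proj₁ parts

  β! : Unique β
  β! with _ ∷ β! ← proj₁ (proj₂ parts) = β!

  α∩β≡∅ : ∀ {x} → x ∈ α → x ∉ β
  α∩β≡∅ x∈α x∈β = proj₂ (proj₂ parts) x∈α (there x∈β)

  α∪β⊆ : ∀ {x} → x ∈ α ⊎ x ∈ β → x ≢ e × s ≤ x × x < s + m
  α∪β⊆ (inj₁ x∈α) = (λ { refl → proj₂ (proj₂ parts) x∈α (here refl) }) , bounded r (∈-++⁺ˡ x∈α)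
  α∪β⊆ (inj₂ x∈β) with e∉β ∷ _ ← proj₁ (proj₂ parts) =
    (λ { refl → All.lookup e∉β x∈β refl }) , bounded r (∈-++⁺ʳ α (there x∈β))

  ⊆α∪β : ∀ {x} → s ≤ x → x < s + m → x ≢ e → x ∈ α ⊎ x ∈ β
  ⊆α∪β s≤x x<s+m x≢e with ∈-++⁻ α (covers r s≤x x<s+m)
  ... | inj₁ x∈α          = inj₁ x∈α
  ... | inj₂ (here x≡e)   = ⊥-elim (x≢e x≡e)
  ... | inj₂ (there x∈β)  = inj₂ x∈β

-- Occurrences of patterns

data Subseq₂ (x y : ℕ) : List ℕ → Set where
  here₂  : ∀ {l} → y ∈ l → Subseq₂ x y (x ∷ l)
  there₂ : ∀ {z l} → Subseq₂ x y l → Subseq₂ x y (z ∷ l)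

data Subseq₃ (x y z : ℕ) : List ℕ → Set where
  here₃  : ∀ {l} → Subseq₂ y z l → Subseq₃ x y z (x ∷ l)
  there₃ : ∀ {w l} → Subseq₃ x y z l → Subseq₃ x y z (w ∷ l)

Contains : (ℕ → ℕ → ℕ → Set) → List ℕ → Set
Contains R u = Σ ℕ λ x → Σ ℕ λ y → Σ ℕ λ z → R x y z × Subseq₃ x y z u

data HasΩ : List ℕ → Set where
  hereΩ  : ∀ {a b l} → b < a → Any (λ c → b ≡ suc c) l → HasΩ (a ∷ b ∷ l)
  thereΩ : ∀ {x l} → HasΩ l → HasΩ (x ∷ l)

Subseq₂-++⁺ˡ : ∀ {x y xs} ys → Subseq₂ x y xs → Subseq₂ x y (xs ++ ys)
Subseq₂-++⁺ˡ ys (here₂ y∈)  = here₂ (∈-++⁺ˡ y∈)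
Subseq₂-++⁺ˡ ys (there₂ s) = there₂ (Subseq₂-++⁺ˡ ys s)

Subseq₂-++⁺ʳ : ∀ {x y ys} xs → Subseq₂ x y ys → Subseq₂ x y (xs ++ ys)
Subseq₂-++⁺ʳ []       s = s
Subseq₂-++⁺ʳ (_ ∷ xs) s = there₂ (Subseq₂-++⁺ʳ xs s)

Subseq₃-++⁺ˡ : ∀ {x y z xs} ys → Subseq₃ x y z xs → Subseq₃ x y z (xs ++ ys)
Subseq₃-++⁺ˡ ys (here₃ s)  = here₃ (Subseq₂-++⁺ˡ ys s)
Subseq₃-++⁺ˡ ys (there₃ s) = there₃ (Subseq₃-++⁺ˡ ys s)

Subseq₃-++⁺ʳ : ∀ {x y z ys} xs → Subseq₃ x y z ys → Subseq₃ x y z (xs ++ ys)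
Subseq₃-++⁺ʳ []       s = s
Subseq₃-++⁺ʳ (_ ∷ xs) s = there₃ (Subseq₃-++⁺ʳ xs s)

Subseq₃-++⁺ : ∀ {x y z xs ys} → x ∈ xs → Subseq₂ y z ys → Subseq₃ x y z (xs ++ ys)
Subseq₃-++⁺ {xs = _ ∷ xs} (here refl) s = here₃ (Subseq₂-++⁺ʳ xs s)
Subseq₃-++⁺ {xs = _ ∷ xs} (there x∈)  s = there₃ (Subseq₃-++⁺ x∈ s)

HasΩ-++⁺ˡ : ∀ {xs} ys → HasΩ xs → HasΩ (xs ++ ys)
HasΩ-++⁺ˡ ys (hereΩ b<a c∈) = hereΩ b<a (Any.++⁺ˡ c∈)
HasΩ-++⁺ˡ ys (thereΩ o)     = thereΩ (HasΩ-++⁺ˡ ys o)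

HasΩ-++⁺ʳ : ∀ {ys} xs → HasΩ ys → HasΩ (xs ++ ys)
HasΩ-++⁺ʳ []       o = o
HasΩ-++⁺ʳ (_ ∷ xs) o = thereΩ (HasΩ-++⁺ʳ xs o)

Contains-++⁺ˡ : ∀ {R xs} ys → Contains R xs → Contains R (xs ++ ys)
Contains-++⁺ˡ ys (x , y , z , r , s) = x , y , z , r , Subseq₃-++⁺ˡ ys s

Contains-++⁺ʳ : ∀ {R ys} xs → Contains R ys → Contains R (xs ++ ys)
Contains-++⁺ʳ xs (x , y , z , r , s) = x , y , z , r , Subseq₃-++⁺ʳ xs s

Subseq₂-++⁻ : ∀ {x y} xs {ys} → Subseq₂ x y (xs ++ ys) → Subseq₂ x y xs ⊎ (x ∈ xs × y ∈ ys) ⊎ Subseq₂ x y ys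
Subseq₂-++⁻ []       s = inj₂ (inj₂ s)
Subseq₂-++⁻ (_ ∷ xs) (here₂ y∈) with ∈-++⁻ xs y∈
... | inj₁ y∈xs = inj₁ (here₂ y∈xs)
... | inj₂ y∈ys = inj₂ (inj₁ (here refl , y∈ys))
Subseq₂-++⁻ (_ ∷ xs) (there₂ s) with Subseq₂-++⁻ xs s
... | inj₁ s′               = inj₁ (there₂ s′)
... | inj₂ (inj₁ (x∈ , y∈)) = inj₂ (inj₁ (there x∈ , y∈))
... | inj₂ (inj₂ s′)        = inj₂ (inj₂ s′)

data Subseq₃-++-View (x y z : ℕ) (xs ys : List ℕ) : Set where
  left  : Subseq₃ x y z xs → Subseq₃-++-View x y z xs ys
  x-yz  : x ∈ xs → Subseq₂ y z ys → Subseq₃-++-View x y z xs ys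
  xy-z  : Subseq₂ x y xs → z ∈ ys → Subseq₃-++-View x y z xs ys
  right : Subseq₃ x y z ys → Subseq₃-++-View x y z xs ys

Subseq₃-++⁻ : ∀ {x y z} xs {ys} → Subseq₃ x y z (xs ++ ys) → Subseq₃-++-View x y z xs ys
Subseq₃-++⁻ []       s = right s
Subseq₃-++⁻ (_ ∷ xs) (here₃ s) with Subseq₂-++⁻ xs s
... | inj₁ s′               = left (here₃ s′)
... | inj₂ (inj₁ (y∈ , z∈)) = xy-z (here₂ y∈) z∈
... | inj₂ (inj₂ s′)        = x-yz (here refl) s′
Subseq₃-++⁻ (_ ∷ xs) (there₃ s) with Subseq₃-++⁻ xs s
... | left s′      = left (there₃ s′)
... | x-yz x∈ s′   = x-yz (there x∈) s′
... | xy-z s′ z∈   = xy-z (there₂ s′) z∈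
... | right s′     = right s′

data HasΩ-++-View (xs ys : List ℕ) : Set where
  left           : HasΩ xs → HasΩ-++-View xs ys
  descent-left   : ∀ {b c} → b ∈ List.drop 1 xs → c ∈ ys → b ≡ suc c → HasΩ-++-View xs ys
  descent-across : ∀ {a b l} → a ∈ xs → ys ≡ b ∷ l → b < a → Any (λ c → b ≡ suc c) l → HasΩ-++-View xs ys
  right          : HasΩ ys → HasΩ-++-View xs ys

HasΩ-++⁻ : ∀ xs {ys} → HasΩ (xs ++ ys) → HasΩ-++-View xs ys
HasΩ-++⁻ []           o = right o
HasΩ-++⁻ (_ ∷ [])     (hereΩ b<a c∈) = descent-across (here refl) refl b<a c∈
HasΩ-++⁻ (_ ∷ [])     (thereΩ o)     = right o
HasΩ-++⁻ (_ ∷ _ ∷ xs) (hereΩ b<a c∈) with Any.++⁻ xs c∈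
... | inj₁ c∈xs = left (hereΩ b<a c∈xs)
... | inj₂ c∈ys with c , c∈ , refl ← find c∈ys = descent-left (here refl) c∈ refl
HasΩ-++⁻ (_ ∷ xs@(_ ∷ _)) (thereΩ o) with HasΩ-++⁻ xs o
... | left o′                    = left (thereΩ o′)
... | descent-left b∈ c∈ eq      = descent-left (there b∈) c∈ eq
... | descent-across a∈ eq b<a c∈ = descent-across (there a∈) eq b<a c∈
... | right o′                   = right o′

Subseq₂⇒∈ˡ : ∀ {x y l} → Subseq₂ x y l → x ∈ l
Subseq₂⇒∈ˡ (here₂ _)  = here refl
Subseq₂⇒∈ˡ (there₂ s) = there (Subseq₂⇒∈ˡ s)

Subseq₂⇒∈ʳ : ∀ {x y l} → Subseq₂ x y l → y ∈ l
Subseq₂⇒∈ʳ (here₂ y∈) = there y∈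
Subseq₂⇒∈ʳ (there₂ s) = there (Subseq₂⇒∈ʳ s)

∈-drop-1⁻ : ∀ {x : ℕ} l → x ∈ List.drop 1 l → x ∈ l
∈-drop-1⁻ (_ ∷ _) x∈ = there x∈

¬HasΩ-[_] : ∀ x → ¬ HasΩ (x ∷ [])
¬HasΩ-[ _ ] (thereΩ ())

¬Subseq₂-[_] : ∀ {y z} x → ¬ Subseq₂ y z (x ∷ [])
¬Subseq₂-[ _ ] (here₂ ())
¬Subseq₂-[ _ ] (there₂ ())

¬Subseq₃-[_] : ∀ {x y z} w → ¬ Subseq₃ x y z (w ∷ [])
¬Subseq₃-[ _ ] (here₃ ())
¬Subseq₃-[ _ ] (there₃ ())

HasΩ-∷-min⁻ : ∀ {x l} → (∀ {y} → y ∈ l → x < y) → HasΩ (x ∷ l) → HasΩ l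
HasΩ-∷-min⁻ x<l (hereΩ b<x _) = ⊥-elim (<-asym b<x (x<l (here refl)))
HasΩ-∷-min⁻ x<l (thereΩ o)    = o

range-head≡min : ∀ {s m a b l} → IsRange s m (b ∷ l) → b < a → ¬ HasΩ (a ∷ b ∷ l) → b ≡ s
range-head≡min {s} {b = b} r b<a ¬Ω with b ≟ s
... | yes b≡s = b≡s
... | no  b≢s = ⊥-elim (¬Ω (hereΩ b<a (predecessor-∈ r (≤∧≢⇒< (proj₁ (bounded r (here refl))) (b≢s ∘ sym)))))
  where
  predecessor-∈ : ∀ {s m b l} → IsRange s m (b ∷ l) → s < b → Any (λ c → b ≡ suc c) l
  predecessor-∈ {b = suc c} r (s≤s s≤c) with covers r s≤c (<-trans (n<1+n c) (proj₂ (bounded r (here refl))))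
  ... | here c≡1+c = ⊥-elim (<-irrefl c≡1+c (n<1+n c))
  ... | there c∈l  = Any.map (λ { refl → refl }) c∈l

HasΩ-descent-to-min : ∀ {y} l r → (∀ {x} → x ∈ l → y ≤ x) → Unique l → y ∈ List.drop 1 l →
                      Any (λ c → y ≡ suc c) r → HasΩ (l ++ r)
HasΩ-descent-to-min (x ∷ _ ∷ l) r y≤l ((x≢y ∷ _) ∷ _) (here refl) c∈r =
  hereΩ (≤∧≢⇒< (y≤l (here refl)) (x≢y ∘ sym)) (Any.++⁺ʳ l c∈r)
HasΩ-descent-to-min (_ ∷ x′ ∷ l) r y≤l (_ ∷ l!) (there y∈) c∈r =
  thereΩ (HasΩ-descent-to-min (x′ ∷ l) r (y≤l ∘ there) l! y∈ c∈r)

private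
  Subseq₂-shift⁻ : ∀ s {x y w} → Subseq₂ x y (shift s w) →
    Σ ℕ λ x₀ → Σ ℕ λ y₀ → x ≡ x₀ + s × y ≡ y₀ + s × Subseq₂ x₀ y₀ w
  Subseq₂-shift⁻ s {w = x₀ ∷ w} (here₂ y∈) with y₀ , y₀∈ , refl ← ∈-map⁻ (_+ s) y∈ = x₀ , y₀ , refl , refl , here₂ y₀∈
  Subseq₂-shift⁻ s {w = _ ∷ w}  (there₂ p) with x₀ , y₀ , refl , refl , p₀ ← Subseq₂-shift⁻ s p =
    x₀ , y₀ , refl , refl , there₂ p₀

  Subseq₃-shift⁻ : ∀ s {x y z w} → Subseq₃ x y z (shift s w) →
    Σ ℕ λ x₀ → Σ ℕ λ y₀ → Σ ℕ λ z₀ → x ≡ x₀ + s × y ≡ y₀ + s × z ≡ z₀ + s × Subseq₃ x₀ y₀ z₀ w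
  Subseq₃-shift⁻ s {w = x₀ ∷ w} (here₃ p) with y₀ , z₀ , refl , refl , p₀ ← Subseq₂-shift⁻ s p =
    x₀ , y₀ , z₀ , refl , refl , refl , here₃ p₀
  Subseq₃-shift⁻ s {w = _ ∷ w}  (there₃ p) with x₀ , y₀ , z₀ , refl , refl , refl , p₀ ← Subseq₃-shift⁻ s p =
    x₀ , y₀ , z₀ , refl , refl , refl , there₃ p₀

  Subseq₂-shift⁺ : ∀ s {x y w} → Subseq₂ x y w → Subseq₂ (x + s) (y + s) (shift s w)
  Subseq₂-shift⁺ s (here₂ y∈) = here₂ (∈-map⁺ (_+ s) y∈)
  Subseq₂-shift⁺ s (there₂ p) = there₂ (Subseq₂-shift⁺ s p)

  Subseq₃-shift⁺ : ∀ s {x y z w} → Subseq₃ x y z w → Subseq₃ (x + s) (y + s) (z + s) (shift s w)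
  Subseq₃-shift⁺ s (here₃ p)  = here₃ (Subseq₂-shift⁺ s p)
  Subseq₃-shift⁺ s (there₃ p) = there₃ (Subseq₃-shift⁺ s p)

module _ {R : ℕ → ℕ → ℕ → Set} (s : ℕ) where

  Contains-shift⁻ : (∀ {x y z} → R (x + s) (y + s) (z + s) → R x y z) →
                    ∀ {w} → Contains R (shift s w) → Contains R w
  Contains-shift⁻ R-unshift (_ , _ , _ , r , p) with x₀ , y₀ , z₀ , refl , refl , refl , p₀ ← Subseq₃-shift⁻ s p =
    x₀ , y₀ , z₀ , R-unshift r , p₀

  Contains-shift⁺ : (∀ {x y z} → R x y z → R (x + s) (y + s) (z + s)) →
                    ∀ {w} → Contains R w → Contains R (shift s w)
  Contains-shift⁺ R-shift (x , y , z , r , p) = x + s , y + s , z + s , R-shift r , Subseq₃-shift⁺ s p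

HasΩ-shift⁻ : ∀ s {w} → HasΩ (shift s w) → HasΩ w
HasΩ-shift⁻ s {_ ∷ _ ∷ w} (hereΩ b<a c∈) =
  hereΩ (+-cancelʳ-< s _ _ b<a) (Any.map (λ {c} eq → +-cancelʳ-≡ s _ (suc c) eq) (Any.map⁻ c∈))
HasΩ-shift⁻ s {_ ∷ w}     (thereΩ o)     = thereΩ (HasΩ-shift⁻ s o)

HasΩ-shift⁺ : ∀ s {w} → HasΩ w → HasΩ (shift s w)
HasΩ-shift⁺ s (hereΩ b<a c∈) = hereΩ (+-monoˡ-< s b<a) (Any.map⁺ (Any.map (cong (_+ s)) c∈))
HasΩ-shift⁺ s (thereΩ o)     = thereΩ (HasΩ-shift⁺ s o)

record Avoider (R : ℕ → ℕ → ℕ → Set) (n : ℕ) (u : List ℕ) : Set where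
  constructor avoider
  field
    perm     : IsRange 0 n u
    avoidsΩ  : ¬ HasΩ u
    avoidsR  : ¬ Contains R u
open Avoider public

module _ {R : ℕ → ℕ → ℕ → Set} where

  Avoider-[] : Avoider R 0 []
  Avoider-[] = avoider IsRange-[] (λ ()) λ { (_ , _ , _ , _ , ()) }

  Avoider-zero : ∀ {u} → Avoider R 0 u → u ≡ []
  Avoider-zero {[]}    _ = refl
  Avoider-zero {_ ∷ _} a = ⊥-elim (<⇒≱ (proj₂ (bounded (perm a) (here refl))) z≤n)

  Avoider-sub : ∀ {n k u w} → Avoider R n u → IsRange 0 k w →
                (HasΩ w → HasΩ u) → (Contains R w → Contains R u) → Avoider R k w
  Avoider-sub a r embedΩ embedR = avoider r (avoidsΩ a ∘ embedΩ) (avoidsR a ∘ embedR)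

  Avoider-unshift : ∀ s → (∀ {x y z} → R x y z → R (x + s) (y + s) (z + s)) →
                    ∀ {n k u w} → Avoider R n u → IsRange s k w →
                    (HasΩ w → HasΩ u) → (Contains R w → Contains R u) →
                    Σ (List ℕ) λ w₀ → Avoider R k w₀ × shift s w₀ ≡ w
  Avoider-unshift s R-shift a r embedΩ embedR with w₀ , r₀ , refl ← IsRange-unshift s r =
    w₀ , Avoider-sub a r₀ (embedΩ ∘ HasΩ-shift⁺ s) (embedR ∘ Contains-shift⁺ s R-shift) , refl

-- The recursively generated families

private
  ∈-zip-downFrom-applyUpTo⁻ : ∀ n (f : ℕ → ℕ) {a b} → (a , b) ∈ List.zip (downFrom n) (applyUpTo f n) →
                               Σ ℕ λ i → b ≡ f i × suc (a + i) ≡ n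
  ∈-zip-downFrom-applyUpTo⁻ (suc n) f {a} (here refl) = 0 , refl , cong suc (+-identityʳ a)
  ∈-zip-downFrom-applyUpTo⁻ (suc n) f {a} (there p) with i , refl , eq ← ∈-zip-downFrom-applyUpTo⁻ n (f ∘ suc) p =
    suc i , refl , cong suc (trans (+-suc a i) eq)

  ∈-zip-downFrom-applyUpTo⁺ : ∀ n (f : ℕ → ℕ) a i → suc (a + i) ≡ n → (a , f i) ∈ List.zip (downFrom n) (applyUpTo f n)
  ∈-zip-downFrom-applyUpTo⁺ (suc n) f a zero    eq with refl ← trans (sym (+-identityʳ a)) (suc-injective eq) = here refl
  ∈-zip-downFrom-applyUpTo⁺ (suc n) f a (suc i) eq =
    there (∈-zip-downFrom-applyUpTo⁺ n (f ∘ suc) a i (trans (sym (+-suc a i)) (suc-injective eq)))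

  ∈-zip⁻ˡ : ∀ {a b : ℕ} xs ys → (a , b) ∈ List.zip xs ys → a ∈ xs
  ∈-zip⁻ˡ (_ ∷ xs) (_ ∷ ys) (here refl) = here refl
  ∈-zip⁻ˡ (_ ∷ xs) (_ ∷ ys) (there p)   = there (∈-zip⁻ˡ xs ys p)

Splits : ℕ → List (ℕ × ℕ)
Splits n = List.zip (downFrom n) (upTo n)

∈-Splits⁻ : ∀ {n a b} → (a , b) ∈ Splits n → suc (a + b) ≡ n
∈-Splits⁻ {n} p with _ , refl , eq ← ∈-zip-downFrom-applyUpTo⁻ n id p = eq

∈-Splits⁺ : ∀ {n a b} → suc (a + b) ≡ n → (a , b) ∈ Splits n
∈-Splits⁺ {n} {a} {b} = ∈-zip-downFrom-applyUpTo⁺ n id a b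

Splits-unique : ∀ n → Unique (Splits n)
Splits-unique n = zip-unique (Unique.downFrom⁺ n)
  where
  zip-unique : ∀ {xs ys : List ℕ} → Unique xs → Unique (List.zip xs ys)
  zip-unique {[]}              _            = []
  zip-unique {_ ∷ _} {[]}      _            = []
  zip-unique {x ∷ xs} {_ ∷ ys} (x∉xs ∷ xs!) =
    All.tabulate (λ { p refl → All.lookup x∉xs (∈-zip⁻ˡ xs ys p) refl }) ∷ zip-unique xs!

summand<ˡ : ∀ {a b n} → suc (a + b) ≡ n → a < n
summand<ˡ {a} {b} refl = s≤s (m≤m+n a b)

summand<ʳ : ∀ {a b n} → suc (a + b) ≡ n → b < n
summand<ʳ {a} {b} refl = s≤s (m≤n+m b a)

module MotzkinFamily (F : ℕ → List ℕ → List ℕ) (H : ℕ → List ℕ → List ℕ → List ℕ) where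

  join : ℕ → List (List ℕ) → List (List ℕ) → List (List ℕ)
  join n X Y = concatMap (λ α → map (H n α) Y) X

  ∈-join⁻ : ∀ {n X Y u} → u ∈ join n X Y → Σ (List ℕ) λ α → Σ (List ℕ) λ β → α ∈ X × β ∈ Y × u ≡ H n α β
  ∈-join⁻ {n} {X} {Y} u∈
    with α , α∈ , u∈Hα ← find (∈-concatMap⁻ (λ α → map (H n α) Y) {xs = X} u∈)
    with β , β∈ , eq ← ∈-map⁻ (H n α) u∈Hα = α , β , α∈ , β∈ , eq

  private
    step : ℕ → List (List (List ℕ)) → List (List (List ℕ))
    step n []       = ([] ∷ []) ∷ []
    step n (X ∷ Xs) = (map (F n) X ++ concat (zipWith (join n) Xs (reverse Xs))) ∷ X ∷ Xs

    head : List (List (List ℕ)) → List (List ℕ)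
    head []      = []
    head (X ∷ _) = X

  -- families n = family n ∷ family (n ∸ 1) ∷ ⋯ ∷ family 0, built exactly like motzkinsRev.
  families : ℕ → List (List (List ℕ))
  families zero    = ([] ∷ []) ∷ []
  families (suc n) = step n (families n)

  family : ℕ → List (List ℕ)
  family n = head (families n)

  joined : ℕ → ℕ × ℕ → List (List ℕ)
  joined n (a , b) = join n (family a) (family b)

  families≡ : ∀ n → families n ≡ family n ∷ map family (downFrom n)
  families≡ zero = refl
  families≡ (suc n) rewrite families≡ n = refl

  private
    length-join : ∀ n X Y → length (join n X Y) ≡ length X * length Y
    length-join n []      Y = refl
    length-join n (α ∷ X) Y = trans (length-++ (map (H n α) Y)) (cong₂ _+_ (length-map (H n α) Y) (length-join n X Y))

    length-concat-zipWith-join : ∀ n Xs Ys →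
      length (concat (zipWith (join n) Xs Ys)) ≡ sum (zipWith _*_ (map length Xs) (map length Ys))
    length-concat-zipWith-join n []       Ys       = refl
    length-concat-zipWith-join n (X ∷ Xs) []       = refl
    length-concat-zipWith-join n (X ∷ Xs) (Y ∷ Ys) =
      trans (length-++ (join n X Y)) (cong₂ _+_ (length-join n X Y) (length-concat-zipWith-join n Xs Ys))

  length-families : ∀ n → map length (families n) ≡ motzkinsRev n
  length-families zero = refl
  length-families (suc n) with length-families n
  ... | ih rewrite families≡ n | sym ih = cong (_∷ map length (X ∷ Xs)) (begin
      length (map (F n) X ++ concat (zipWith (join n) Xs (reverse Xs)))
        ≡⟨ length-++ (map (F n) X) ⟩
      length (map (F n) X) + length (concat (zipWith (join n) Xs (reverse Xs)))
        ≡⟨ cong₂ _+_ (length-map (F n) X) (length-concat-zipWith-join n Xs (reverse Xs)) ⟩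
      length X + sum (zipWith _*_ (map length Xs) (map length (reverse Xs)))
        ≡⟨ cong (λ r → length X + sum (zipWith _*_ (map length Xs) r)) (reverse-map length Xs) ⟩
      length X + sum (zipWith _*_ (map length Xs) (reverse (map length Xs))) ∎)
    where
    open ≡-Reasoning
    X : List (List ℕ)
    X = family n
    Xs : List (List (List ℕ))
    Xs = map family (downFrom n)

  length-family : ∀ n → length (family n) ≡ motzkin n
  length-family n with length-families n
  ... | ih rewrite families≡ n | sym ih = refl

  private
    concat-zipWith-join : ∀ n xs ys →
      concat (zipWith (join n) (map family xs) (map family ys)) ≡
      concatMap (joined n) (List.zip xs ys)
    concat-zipWith-join n []       _        = refl
    concat-zipWith-join n (_ ∷ _)  []       = refl
    concat-zipWith-join n (a ∷ xs) (b ∷ ys) = cong (join n (family a) (family b) ++_) (concat-zipWith-join n xs ys)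

  family-suc : ∀ n → family (suc n) ≡
    map (F n) (family n) ++ concatMap (joined n) (Splits n)
  family-suc n rewrite families≡ n = cong (map (F n) (family n) ++_) (begin
      concat (zipWith (join n) (map family (downFrom n)) (reverse (map family (downFrom n))))
        ≡⟨ cong (concat ∘ zipWith (join n) (map family (downFrom n))) (reverse-map family (downFrom n)) ⟨
      concat (zipWith (join n) (map family (downFrom n)) (map family (reverse (downFrom n))))
        ≡⟨ cong (λ l → concat (zipWith (join n) (map family (downFrom n)) (map family l))) (reverse-downFrom n) ⟩
      concat (zipWith (join n) (map family (downFrom n)) (map family (upTo n)))
        ≡⟨ concat-zipWith-join n (downFrom n) (upTo n) ⟩
      concatMap (joined n) (Splits n) ∎)
    where open ≡-Reasoning

  data Decomposition (P : ℕ → List ℕ → Set) (n : ℕ) : List ℕ → Set where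
    viaF : ∀ {v} → P n v → Decomposition P n (F n v)
    viaH : ∀ {a b α β} → suc (a + b) ≡ n → P a α → P b β → Decomposition P n (H n α β)

  Decomposition-map : ∀ {P Q : ℕ → List ℕ → Set} {n u} → (∀ {m w} → m ≤ n → P m w → Q m w) →
                      Decomposition P n u → Decomposition Q n u
  Decomposition-map P⇒Q (viaF p) = viaF (P⇒Q ≤-refl p)
  Decomposition-map P⇒Q (viaH a+b<n p q) = viaH a+b<n (P⇒Q (<⇒≤ (summand<ˡ a+b<n)) p) (P⇒Q (<⇒≤ (summand<ʳ a+b<n)) q)

  InFamily : ℕ → List ℕ → Set
  InFamily n u = u ∈ family n

  ∈-family-suc⁻ : ∀ {n u} → u ∈ family (suc n) → Decomposition InFamily n u
  ∈-family-suc⁻ {n} u∈ rewrite family-suc n with ∈-++⁻ (map (F n) (family n)) u∈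
  ... | inj₁ u∈F with v , v∈ , refl ← ∈-map⁻ (F n) u∈F = viaF v∈
  ... | inj₂ u∈H
    with (a , b) , ab∈ , u∈join ← find (∈-concatMap⁻ (joined n) {xs = Splits n} u∈H)
    with _ , _ , α∈ , β∈ , refl ← ∈-join⁻ {n} {family a} {family b} u∈join = viaH {a = a} {b = b} (∈-Splits⁻ ab∈) α∈ β∈

  ∈-family-suc⁺ : ∀ {n u} → Decomposition InFamily n u → u ∈ family (suc n)
  ∈-family-suc⁺ {n} (viaF v∈) rewrite family-suc n = ∈-++⁺ˡ (∈-map⁺ (F n) v∈)
  ∈-family-suc⁺ {n} (viaH {a} {b} {α} {β} a+b<n α∈ β∈) rewrite family-suc n =
    ∈-++⁺ʳ (map (F n) (family n))
      (∈-concatMap⁺ (joined n) {xs = Splits n}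
        (Any.map (λ { {.(a , b)} refl → u∈join }) (∈-Splits⁺ {n} {a} {b} a+b<n)))
    where
    u∈join : H n α β ∈ join n (family a) (family b)
    u∈join = ∈-concatMap⁺ (λ α → map (H n α) (family b)) {xs = family a}
               (Any.map (λ { {.α} refl → ∈-map⁺ (H n α) β∈ }) α∈)

  module Classification (Good : ℕ → List ℕ → Set)
                        (Good-[] : Good 0 [])
                        (Good-zero : ∀ {u} → Good 0 u → u ≡ [])
                        (compose : ∀ {n u} → Decomposition Good n u → Good (suc n) u)
                        (decompose : ∀ {n u} → Good (suc n) u → Decomposition Good n u) where

    family-sound : ∀ n {u} → u ∈ family n → Good n u
    family-sound = <-rec _ sound
      where
      sound : ∀ n → (∀ {m} → m < n → ∀ {u} → u ∈ family m → Good m u) → ∀ {u} → u ∈ family n → Good n u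
      sound zero    _  (here refl) = Good-[]
      sound (suc n) IH u∈          = compose (Decomposition-map (λ m≤n → IH (s≤s m≤n)) (∈-family-suc⁻ u∈))

    family-complete : ∀ n {u} → Good n u → u ∈ family n
    family-complete = <-rec _ complete
      where
      complete : ∀ n → (∀ {m} → m < n → ∀ {u} → Good m u → u ∈ family m) → ∀ {u} → Good n u → u ∈ family n
      complete zero    _  g with refl ← Good-zero g = here refl
      complete (suc n) IH g = ∈-family-suc⁺ (Decomposition-map (λ m≤n → IH (s≤s m≤n)) (decompose g))

    module Uniqueness (F-injective : ∀ {n v v′} → F n v ≡ F n v′ → v ≡ v′)
                      (H-injective : ∀ {n a b α α′ β β′} → suc (a + b) ≡ n → Good a α → Good a α′ →
                                     H n α β ≡ H n α′ β′ → α ≡ α′ × β ≡ β′)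
                      (position : ℕ → List ℕ → ℕ)
                      (position-F : ∀ {n v} → Good n v → position n (F n v) ≡ n)
                      (position-H : ∀ {n a b α β} → suc (a + b) ≡ n → Good a α → Good b β → position n (H n α β) ≡ a) where

      private
        position-join : ∀ {n} a b {u} → suc (a + b) ≡ n → u ∈ join n (family a) (family b) → position n u ≡ a
        position-join {n} a b a+b<n u∈ with _ , _ , α∈ , β∈ , refl ← ∈-join⁻ {n} {family a} {family b} u∈ =
          position-H a+b<n (family-sound a α∈) (family-sound b β∈)

        join-unique : ∀ {n} a b → suc (a + b) ≡ n → Unique (family a) → Unique (family b) → Unique (join n (family a) (family b))
        join-unique {n} a b a+b<n Fa! Fb! =
          Unique-concatMap⁺ (λ α → map (H n α) (family b)) Fa!
            (λ α∈ → Unique-map⁺ (λ _ _ eq → proj₂ (H-injective a+b<n (family-sound a α∈) (family-sound a α∈) eq)) Fb!)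
            λ α∈ α′∈ u∈ u∈′ → proj₁ (H-injective a+b<n (family-sound a α∈) (family-sound a α′∈)
                                       (trans (sym (proj₂ (proj₂ (∈-map⁻ (H n _) u∈)))) (proj₂ (proj₂ (∈-map⁻ (H n _) u∈′)))))

      family-unique : ∀ n → Unique (family n)
      family-unique = <-rec _ unique-step
        where
        unique-step : ∀ n → (∀ {m} → m < n → Unique (family m)) → Unique (family n)
        unique-step zero    _  = [] ∷ []
        unique-step (suc n) IH rewrite family-suc n =
          Unique.++⁺ (Unique-map⁺ (λ _ _ → F-injective) (IH ≤-refl))
            (Unique-concatMap⁺ (joined n) (Splits-unique n)
              (λ {(a , b)} ab∈ → join-unique a b (∈-Splits⁻ ab∈) (IH {a} (m<n⇒m<1+n (summand<ˡ (∈-Splits⁻ ab∈))))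
                                                                    (IH {b} (m<n⇒m<1+n (summand<ʳ (∈-Splits⁻ ab∈)))))
              λ {(a , b)} {(a′ , b′)} ab∈ ab′∈ u∈ u∈′ →
                same-split (∈-Splits⁻ ab∈) (∈-Splits⁻ ab′∈)
                  (trans (sym (position-join a b (∈-Splits⁻ ab∈) u∈)) (position-join a′ b′ (∈-Splits⁻ ab′∈) u∈′)))
            F-disjoint-H
          where
          same-split : ∀ {a b a′ b′} → suc (a + b) ≡ n → suc (a′ + b′) ≡ n → a ≡ a′ → (a , b) ≡ (a′ , b′)
          same-split {a} eq eq′ refl = cong (a ,_) (+-cancelˡ-≡ a _ _ (suc-injective (trans eq (sym eq′))))
          F-disjoint-H : ∀ {u} → u ∈ map (F n) (family n) × u ∈ concatMap (joined n) (Splits n) → ⊥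
          F-disjoint-H (u∈F , u∈H)
            with v , v∈ , refl ← ∈-map⁻ (F n) u∈F
            with (a , b) , ab∈ , u∈join ← find (∈-concatMap⁻ (joined n) {xs = Splits n} u∈H) =
            <⇒≢ (summand<ˡ (∈-Splits⁻ ab∈)) (trans (sym (position-join a b (∈-Splits⁻ ab∈) u∈join)) (position-F (family-sound n v∈)))

module Avoiding231 where

  Pattern231 : ℕ → ℕ → ℕ → Set
  Pattern231 x y z = z < x × x < y

  private
    Pattern231-shift : ∀ s {x y z} → Pattern231 x y z → Pattern231 (x + s) (y + s) (z + s)
    Pattern231-shift s (z<x , x<y) = +-monoˡ-< s z<x , +-monoˡ-< s x<y

    Pattern231-unshift : ∀ s {x y z} → Pattern231 (x + s) (y + s) (z + s) → Pattern231 x y z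
    Pattern231-unshift s (z<x , x<y) = +-cancelʳ-< s _ _ z<x , +-cancelʳ-< s _ _ x<y

  Good : ℕ → List ℕ → Set
  Good = Avoider Pattern231

  extend : ℕ → List ℕ → List ℕ
  extend n v = v ++ n ∷ []

  glue : ℕ → List ℕ → List ℕ → List ℕ
  glue n α β = α ++ n ∷ length α ∷ shift (suc (length α)) β

  open MotzkinFamily extend glue public

  extend-good : ∀ {n v} → Good n v → Good (suc n) (extend n v)
  extend-good {n} {v} a = avoider range′ avoidsΩ′ avoids231′
    where
    v<n : ∀ {x} → x ∈ v → x < n
    v<n x∈ = proj₂ (bounded (perm a) x∈)
    range′ : IsRange 0 (suc n) (v ++ n ∷ [])
    range′ = subst (λ m → IsRange 0 m (v ++ n ∷ [])) (+-comm n 1) (IsRange-++ (perm a) (IsRange-∷ IsRange-[]))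
    avoidsΩ′ : ¬ HasΩ (v ++ n ∷ [])
    avoidsΩ′ o with HasΩ-++⁻ v o
    ... | left o′                          = avoidsΩ a o′
    ... | descent-left b∈ (here refl) refl = <-asym (v<n (∈-drop-1⁻ v b∈)) (n<1+n n)
    ... | descent-across a∈ refl n<a _     = <-asym n<a (v<n a∈)
    ... | right o′                         = ¬HasΩ-[ n ] o′
    avoids231′ : ¬ Contains Pattern231 (v ++ n ∷ [])
    avoids231′ (x , y , z , r@(z<x , _) , s) with Subseq₃-++⁻ v s
    ... | left s′             = avoidsR a (x , y , z , r , s′)
    ... | x-yz _ s′           = ¬Subseq₂-[ n ] s′
    ... | xy-z s′ (here refl) = <-asym z<x (v<n (Subseq₂⇒∈ˡ s′))
    ... | right s′            = ¬Subseq₃-[ n ] s′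

  module _ {b α β} (aα : Good (length α) α) (aβ : Good b β) where

    private
      k N : ℕ
      k = length α
      N = suc (k + b)

      S : List ℕ
      S = shift (suc k) β

      rS : IsRange (suc k) b S
      rS = IsRange-shift (suc k) (perm aβ)

      α<k : ∀ {x} → x ∈ α → x < k
      α<k x∈ = proj₂ (bounded (perm aα) x∈)

      k<S : ∀ {x} → x ∈ S → k < x
      k<S x∈ = proj₁ (bounded rS x∈)

      k<N : k < N
      k<N = s≤s (m≤m+n k b)

      k≤tail≤N : ∀ {y} → y ∈ N ∷ k ∷ S → k ≤ y × y ≤ N
      k≤tail≤N (here refl)         = <⇒≤ k<N , ≤-refl
      k≤tail≤N (there (here refl)) = ≤-refl , <⇒≤ k<N
      k≤tail≤N (there (there y∈))  = <⇒≤ (k<S y∈) , <⇒≤ (proj₂ (bounded rS y∈))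

    glue-isRange : IsRange 0 (suc N) (glue N α β)
    glue-isRange = subst (λ m → IsRange 0 m (α ++ N ∷ k ∷ S)) (trans (+-suc k (suc b)) (cong suc (+-suc k b)))
                     (IsRange-++ (perm aα) tail-range)
      where
      tail-range : IsRange k (suc (suc b)) (N ∷ k ∷ S)
      tail-range = subst₂ (λ m e → IsRange k m (e ∷ k ∷ S)) (+-comm (suc b) 1) (+-suc k b)
                     (IsRange-++ᵒᵖ (IsRange-∷ rS) (IsRange-∷ IsRange-[]))

    glue-avoidsΩ : ¬ HasΩ (glue N α β)
    glue-avoidsΩ o with HasΩ-++⁻ α o
    ... | left o′                        = avoidsΩ aα o′
    ... | descent-left b∈ c∈ refl        = <⇒≱ (α<k (∈-drop-1⁻ α b∈)) (≤-trans (proj₁ (k≤tail≤N c∈)) (n≤1+n _))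
    ... | descent-across a∈ refl N<a _   = <-asym (<-trans N<a (α<k a∈)) k<N
    ... | right (hereΩ _ k≡1+c∈S) with c , c∈ , k≡1+c ← find k≡1+c∈S = <-asym (k<S c∈) (≤-reflexive (sym k≡1+c))
    glue-avoidsΩ o | right (thereΩ o′)   = avoidsΩ aβ (HasΩ-shift⁻ (suc k) (HasΩ-∷-min⁻ k<S o′))

    glue-avoids231 : ¬ Contains Pattern231 (glue N α β)
    glue-avoids231 (x , y , z , r@(z<x , x<y) , s) with Subseq₃-++⁻ α s
    ... | left s′                    = avoidsR aα (x , y , z , r , s′)
    ... | x-yz x∈ s′                 = <⇒≱ (<-trans z<x (α<k x∈)) (proj₁ (k≤tail≤N (Subseq₂⇒∈ʳ s′)))
    ... | xy-z s′ z∈                 = <⇒≱ (<-trans z<x (α<k (Subseq₂⇒∈ˡ s′))) (proj₁ (k≤tail≤N z∈))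
    ... | right (here₃ s′)           = <⇒≱ x<y (proj₂ (k≤tail≤N (there (Subseq₂⇒∈ˡ s′))))
    ... | right (there₃ (here₃ s′))  = <-asym z<x (k<S (Subseq₂⇒∈ʳ s′))
    ... | right (there₃ (there₃ s′)) =
      avoidsR aβ (Contains-shift⁻ (suc k) (Pattern231-unshift (suc k)) (x , y , z , r , s′))

  glue-good : ∀ {n a b α β} → suc (a + b) ≡ n → Good a α → Good b β → Good (suc n) (glue n α β)
  glue-good a+b<n aα aβ with refl ← IsRange-length (perm aα) | refl ← a+b<n =
    avoider (glue-isRange aα aβ) (glue-avoidsΩ aα aβ) (glue-avoids231 aα aβ)

  compose : ∀ {n u} → Decomposition Good n u → Good (suc n) u
  compose (viaF a)          = extend-good a
  compose (viaH a+b<n aα aβ) = glue-good a+b<n aα aβ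

  private
    module _ {n : ℕ} (α β : List ℕ) (a : Good (suc n) (α ++ n ∷ β)) where
      open CutAt α (perm a)

      below-max : ∀ {x} → x ∈ α ⊎ x ∈ β → x < n
      below-max x∈ with x≢n , _ , x<1+n ← α∪β⊆ x∈ = ≤∧≢⇒< (≤-pred x<1+n) x≢n

      prefix<suffix : ∀ {x y} → x ∈ α → y ∈ β → x < y
      prefix<suffix {x} {y} x∈α y∈β with <-cmp x y
      ... | tri< x<y _ _  = x<y
      ... | tri≈ _ refl _ = ⊥-elim (α∩β≡∅ x∈α y∈β)
      ... | tri> _ _ y<x  = ⊥-elim (avoidsR a (x , n , y , (y<x , below-max (inj₁ x∈α)) , Subseq₃-++⁺ x∈α (here₂ y∈β)))

      split-at-max : Good (length α) α × IsRange (length α) (n ∸ length α) β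
      split-at-max with rα , rβ ← IsRange-split α! β! α∩β≡∅ (λ x∈ → z≤n , below-max x∈)
                                    (λ _ x<n → ⊆α∪β z≤n (m<n⇒m<1+n x<n) (<⇒≢ x<n)) prefix<suffix =
        Avoider-sub a rα (HasΩ-++⁺ˡ (n ∷ β)) (Contains-++⁺ˡ (n ∷ β)) , rβ

    decompose-at-max : ∀ {n} α β → Good (suc n) (α ++ n ∷ β) → Decomposition Good n (α ++ n ∷ β)
    decompose-at-max {n} α [] a with aα , _ ← split-at-max α [] a =
      viaF (subst (λ k → Good k α) length-α≡n aα)
      where
      length-α≡n : length α ≡ n
      length-α≡n = trans (sym (+-identityʳ (length α))) (suc-injective (trans (sym (length-++-∷ α)) (IsRange-length (perm a))))
    decompose-at-max {n} α (b ∷ β) a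
      with aα , rβ ← split-at-max α (b ∷ β) a
      with refl ← range-head≡min rβ (below-max α (b ∷ β) a (inj₂ (here refl))) (avoidsΩ a ∘ HasΩ-++⁺ʳ α)
      with β₀ , aβ₀ , refl ← Avoider-unshift (suc (length α)) (Pattern231-shift (suc (length α))) a
                               (IsRange-∷⁻ (subst (λ m → IsRange (length α) m (length α ∷ β)) (sym (IsRange-length rβ)) rβ))
                               (HasΩ-++⁺ʳ α ∘ thereΩ ∘ thereΩ) (Contains-++⁺ʳ α ∘ Contains-++⁺ʳ (n ∷ length α ∷ [])) =
      viaH split-sizes aα aβ₀
      where
      split-sizes : suc (length α + length β) ≡ n
      split-sizes = trans (sym (+-suc (length α) _))
                          (suc-injective (trans (sym (length-++-∷ α)) (IsRange-length (perm a))))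

  decompose : ∀ {n u} → Good (suc n) u → Decomposition Good n u
  decompose {n} a with α , β , refl ← ∈-∃++ (covers (perm a) z≤n (n<1+n n)) = decompose-at-max α β a

  open Classification Good Avoider-[] Avoider-zero compose decompose public

  private
    bound∉ : ∀ {n a α} → a ≤ n → Good a α → n ∉ α
    bound∉ a≤n aα n∈α = <⇒≱ (proj₂ (bounded (perm aα) n∈α)) a≤n

    extend-injective : ∀ {n v v′} → extend n v ≡ extend n v′ → v ≡ v′
    extend-injective {n} {v} {v′} = ++-cancelʳ (n ∷ []) v v′

    glue-injective : ∀ {n a b α α′ β β′} → suc (a + b) ≡ n → Good a α → Good a α′ →
                     glue n α β ≡ glue n α′ β′ → α ≡ α′ × β ≡ β′
    glue-injective {α = α} {α′} a+b<n aα aα′ eq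
      with refl , tail≡ ← ++-∷-injective α α′ (bound∉ (<⇒≤ (summand<ˡ a+b<n)) aα) (bound∉ (<⇒≤ (summand<ˡ a+b<n)) aα′) eq =
      refl , shift-injective (suc (length α)) (∷-injectiveʳ tail≡)

    index-of-max-extend : ∀ {n v} → Good n v → index-of n (extend n v) ≡ n
    index-of-max-extend {n} {v} a = trans (index-of-++-∷ v (bound∉ ≤-refl a)) (IsRange-length (perm a))

    index-of-max-glue : ∀ {n a b α β} → suc (a + b) ≡ n → Good a α → Good b β → index-of n (glue n α β) ≡ a
    index-of-max-glue {α = α} a+b<n aα _ = trans (index-of-++-∷ α (bound∉ (<⇒≤ (summand<ˡ a+b<n)) aα)) (IsRange-length (perm aα))

  open Uniqueness extend-injective glue-injective index-of index-of-max-extend index-of-max-glue public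

module Avoiding213 where

  Pattern213 : ℕ → ℕ → ℕ → Set
  Pattern213 x y z = y < x × x < z

  private
    Pattern213-shift : ∀ s {x y z} → Pattern213 x y z → Pattern213 (x + s) (y + s) (z + s)
    Pattern213-shift s (y<x , x<z) = +-monoˡ-< s y<x , +-monoˡ-< s x<z

    Pattern213-unshift : ∀ s {x y z} → Pattern213 (x + s) (y + s) (z + s) → Pattern213 x y z
    Pattern213-unshift s (y<x , x<z) = +-cancelʳ-< s _ _ y<x , +-cancelʳ-< s _ _ x<z

  Good : ℕ → List ℕ → Set
  Good = Avoider Pattern213

  extend : ℕ → List ℕ → List ℕ
  extend _ v = 0 ∷ shift 1 v

  glue : ℕ → List ℕ → List ℕ → List ℕ
  glue _ α β = suc (length β) ∷ shift (suc (suc (length β))) α ++ 0 ∷ shift 1 β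

  open MotzkinFamily extend glue public

  extend-good : ∀ {n v} → Good n v → Good (suc n) (extend n v)
  extend-good {n} {v} a = avoider (IsRange-∷ rS) avoidsΩ′ avoids213′
    where
    rS : IsRange 1 n (shift 1 v)
    rS = IsRange-shift 1 (perm a)
    avoidsΩ′ : ¬ HasΩ (0 ∷ shift 1 v)
    avoidsΩ′ = avoidsΩ a ∘ HasΩ-shift⁻ 1 ∘ HasΩ-∷-min⁻ (proj₁ ∘ bounded rS)
    avoids213′ : ¬ Contains Pattern213 (0 ∷ shift 1 v)
    avoids213′ (_ , _ , _ , (() , _) , here₃ _)
    avoids213′ (x , y , z , r , there₃ s) = avoidsR a (Contains-shift⁻ 1 (Pattern213-unshift 1) (x , y , z , r , s))

  module _ {a α β} (aα : Good a α) (aβ : Good (length β) β) where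

    private
      m : ℕ
      m = length β

      SA SB : List ℕ
      SA = shift (suc (suc m)) α
      SB = shift 1 β

      rA : IsRange (suc (suc m)) a SA
      rA = IsRange-shift (suc (suc m)) (perm aα)

      rB : IsRange 1 m SB
      rB = IsRange-shift 1 (perm aβ)

      upper : ∀ {x} → x ∈ suc m ∷ SA → suc m ≤ x
      upper (here refl) = ≤-refl
      upper (there x∈)  = <⇒≤ (proj₁ (bounded rA x∈))

      lower : ∀ {x} → x ∈ 0 ∷ SB → x ≤ m
      lower (here refl) = z≤n
      lower (there x∈)  = ≤-pred (proj₂ (bounded rB x∈))

    glue-isRange : IsRange 0 (suc (suc (a + m))) (glue (suc (a + m)) α β)
    glue-isRange = subst (λ k → IsRange 0 k (glue (suc (a + m)) α β)) (cong suc (trans (+-suc m a) (cong suc (+-comm m a))))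
                     (IsRange-++ᵒᵖ (IsRange-∷ rB) (IsRange-∷ rA))

    glue-avoidsΩ : ¬ HasΩ (glue (suc (a + m)) α β)
    glue-avoidsΩ o with HasΩ-++⁻ (suc m ∷ SA) o
    ... | left o′                     = avoidsΩ aα (HasΩ-shift⁻ (suc (suc m)) (HasΩ-∷-min⁻ (proj₁ ∘ bounded rA) o′))
    ... | descent-left b∈ c∈ refl     = <⇒≱ (≤-pred (proj₁ (bounded rA b∈))) (lower c∈)
    ... | descent-across _ refl _ 0≡1+c∈ with _ , _ , () ← find 0≡1+c∈
    glue-avoidsΩ o | right o′         = avoidsΩ aβ (HasΩ-shift⁻ 1 (HasΩ-∷-min⁻ (proj₁ ∘ bounded rB) o′))

    glue-avoids213 : ¬ Contains Pattern213 (glue (suc (a + m)) α β)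
    glue-avoids213 (x , y , z , r@(y<x , x<z) , s) with Subseq₃-++⁻ (suc m ∷ SA) s
    ... | left (here₃ s′)   = <-asym y<x (proj₁ (bounded rA (Subseq₂⇒∈ˡ s′)))
    ... | left (there₃ s′)  =
      avoidsR aα (Contains-shift⁻ (suc (suc m)) (Pattern213-unshift (suc (suc m))) (x , y , z , r , s′))
    ... | x-yz x∈ s′        = <⇒≱ (<-≤-trans x<z (lower (Subseq₂⇒∈ʳ s′))) (<⇒≤ (upper x∈))
    ... | xy-z s′ z∈        = <⇒≱ (<-≤-trans x<z (lower z∈)) (<⇒≤ (upper (Subseq₂⇒∈ˡ s′)))
    ... | right (here₃ _)   with () ← y<x
    ... | right (there₃ s′) = avoidsR aβ (Contains-shift⁻ 1 (Pattern213-unshift 1) (x , y , z , r , s′))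

  glue-good : ∀ {n a b α β} → suc (a + b) ≡ n → Good a α → Good b β → Good (suc n) (glue n α β)
  glue-good a+b<n aα aβ with refl ← IsRange-length (perm aβ) | refl ← a+b<n =
    avoider (glue-isRange aα aβ) (glue-avoidsΩ aα aβ) (glue-avoids213 aα aβ)

  compose : ∀ {n u} → Decomposition Good n u → Good (suc n) u
  compose (viaF a)           = extend-good a
  compose (viaH a+b<n aα aβ) = glue-good a+b<n aα aβ

  private
    module _ {n : ℕ} (α β : List ℕ) (a : Good (suc n) (α ++ 0 ∷ β)) where
      open CutAt α (perm a)

      suffix<prefix : ∀ {y x} → y ∈ β → x ∈ α → y < x
      suffix<prefix {y} {x} y∈β x∈α with <-cmp y x
      ... | tri< y<x _ _  = y<x
      ... | tri≈ _ refl _ = ⊥-elim (α∩β≡∅ x∈α y∈β)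
      ... | tri> _ _ x<y  = ⊥-elim (avoidsR a (x , 0 , y , (0<x , x<y) , Subseq₃-++⁺ x∈α (here₂ y∈β)))
        where
        0<x : 0 < x
        0<x = ≤∧≢⇒< z≤n (proj₁ (α∪β⊆ (inj₁ x∈α)) ∘ sym)

      split-at-min : IsRange 1 (length β) β × IsRange (1 + length β) (n ∸ length β) α
      split-at-min = IsRange-split β! α! (λ x∈β x∈α → α∩β≡∅ x∈α x∈β) bounded′ covers′ suffix<prefix
        where
        bounded′ : ∀ {x} → x ∈ β ⊎ x ∈ α → 1 ≤ x × x < 1 + n
        bounded′ x∈ with x≢0 , _ , x<1+n ← α∪β⊆ (Data.Sum.swap x∈) = ≤∧≢⇒< z≤n (x≢0 ∘ sym) , x<1+n
        covers′ : ∀ {x} → 1 ≤ x → x < 1 + n → x ∈ β ⊎ x ∈ α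
        covers′ 0<x x<1+n = Data.Sum.swap (⊆α∪β z≤n x<1+n (<⇒≢ 0<x ∘ sym))

    ω-unless-upper-first : ∀ {a₀ α β k m} → IsRange 1 m β → IsRange (suc m) k (a₀ ∷ α) → a₀ ≢ suc m → HasΩ (a₀ ∷ α ++ 0 ∷ β)
    ω-unless-upper-first {a₀} {α} {β} {m = m} rβ rα a₀≢1+m =
      HasΩ-descent-to-min (a₀ ∷ α) (0 ∷ β) (proj₁ ∘ bounded rα) (unique rα) 1+m∈α (m∈0∷β m rβ)
      where
      1+m∈α : suc m ∈ α
      1+m∈α with covers rα ≤-refl (uncurry ≤-<-trans (bounded rα (here refl)))
      ... | here 1+m≡a₀ = ⊥-elim (a₀≢1+m (sym 1+m≡a₀))
      ... | there 1+m∈  = 1+m∈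
      m∈0∷β : ∀ m → IsRange 1 m β → Any (λ c → suc m ≡ suc c) (0 ∷ β)
      m∈0∷β zero    _  = here refl
      m∈0∷β (suc m) rβ = there (Any.map (cong suc) (covers rβ (s≤s z≤n) ≤-refl))

    decompose-at-min : ∀ {n} α β → Good (suc n) (α ++ 0 ∷ β) → Decomposition Good n (α ++ 0 ∷ β)
    decompose-at-min {n} α β a
      with rβ , rα ← split-at-min α β a
      with β₀ , aβ₀ , refl ← Avoider-unshift 1 (Pattern213-shift 1) a rβ (HasΩ-++⁺ʳ α ∘ thereΩ)
                               (Contains-++⁺ʳ α ∘ Contains-++⁺ʳ (0 ∷ []))
      = decompose-upper α rα a
      where
      m : ℕ
      m = length (shift 1 β₀)

      decompose-upper : ∀ α → IsRange (1 + m) (n ∸ m) α → Good (suc n) (α ++ 0 ∷ shift 1 β₀) →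
                        Decomposition Good n (α ++ 0 ∷ shift 1 β₀)
      decompose-upper [] _ a = viaF (subst (λ k → Good k β₀) length-β≡n aβ₀)
        where
        length-β≡n : m ≡ n
        length-β≡n = suc-injective (IsRange-length (perm a))
      decompose-upper (a₀ ∷ α) rα a with a₀ ≟ suc m
      ... | no  a₀≢1+m = ⊥-elim (avoidsΩ a (ω-unless-upper-first rβ rα a₀≢1+m))
      ... | yes refl
        with α₀ , aα₀ , refl ← Avoider-unshift (suc (suc m)) (Pattern213-shift (suc (suc m))) a
                                 (IsRange-∷⁻ (subst (λ k → IsRange (suc m) k (suc m ∷ α)) (sym (IsRange-length rα)) rα))
                                 (thereΩ ∘ HasΩ-++⁺ˡ (0 ∷ shift 1 β₀))
                                 (Contains-++⁺ʳ (suc m ∷ []) ∘ Contains-++⁺ˡ (0 ∷ shift 1 β₀))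
        = subst (Decomposition Good n) glue≡ (viaH split-sizes aα₀ aβ₀)
        where
        split-sizes : suc (length (shift (suc (suc m)) α₀) + m) ≡ n
        split-sizes = suc-injective (trans (sym (length-++-∷ (suc m ∷ shift (suc (suc m)) α₀))) (IsRange-length (perm a)))
        glue≡ : glue n α₀ β₀ ≡ suc m ∷ shift (suc (suc m)) α₀ ++ 0 ∷ shift 1 β₀
        glue≡ = cong (λ k → suc k ∷ shift (suc (suc k)) α₀ ++ 0 ∷ shift 1 β₀) (sym (length-map (_+ 1) β₀))

  decompose : ∀ {n u} → Good (suc n) u → Decomposition Good n u
  decompose a with α , β , refl ← ∈-∃++ (covers (perm a) z≤n (s≤s z≤n)) = decompose-at-min α β a

  open Classification Good Avoider-[] Avoider-zero compose decompose public

  private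
    extend-injective : ∀ {n v v′} → extend n v ≡ extend n v′ → v ≡ v′
    extend-injective eq = shift-injective 1 (∷-injectiveʳ eq)

    glue-injective : ∀ {n a b α α′ β β′} → suc (a + b) ≡ n → Good a α → Good a α′ →
                     glue n α β ≡ glue n α′ β′ → α ≡ α′ × β ≡ β′
    glue-injective {α = α} {α′} {β} {β′} _ _ _ eq
      with SA≡SA′ , SB≡SB′ ← ++-∷-injective (shift (suc (suc (length β))) α) (shift (suc (suc (length β′))) α′)
                                (0∉shift (suc (length β)) α) (0∉shift (suc (length β′)) α′) (∷-injectiveʳ eq) =
      shift-injective (suc (suc (length β))) (trans SA≡SA′ (cong (λ k → shift (suc (suc k)) α′) (sym |β|≡|β′|))) ,
      shift-injective 1 SB≡SB′
      where
      |β|≡|β′| : length β ≡ length β′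
      |β|≡|β′| = suc-injective (∷-injectiveˡ eq)

    -- 0 comes first in extend n v and right after the block of α in glue n α β.
    summand : ℕ → List ℕ → ℕ
    summand n u with index-of 0 u
    ... | zero  = n
    ... | suc i = i

    summand-extend : ∀ {n v} → Good n v → summand n (extend n v) ≡ n
    summand-extend _ = refl

    summand-glue : ∀ {n a b α β} → suc (a + b) ≡ n → Good a α → Good b β → summand n (glue n α β) ≡ a
    summand-glue {α = α} {β} _ aα _
      rewrite index-of-++-∷ (shift (suc (suc (length β))) α) {shift 1 β} (0∉shift (suc (length β)) α) =
      trans (length-map (_+ suc (suc (length β))) α) (IsRange-length (perm aα))

  open Uniqueness (λ {n} → extend-injective {n}) glue-injective summand summand-extend summand-glue public

-- Words as lists of values

values : ∀ {n m} → Vec (Fin n) m → List ℕ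
values []      = []
values (a ∷ v) = toℕ a ∷ values v

values-injective : ∀ {n m} {v w : Vec (Fin n) m} → values v ≡ values w → v ≡ w
values-injective {v = []}    {[]}    _  = refl
values-injective {v = _ ∷ _} {_ ∷ _} eq = cong₂ _∷_ (FinP.toℕ-injective (∷-injectiveˡ eq)) (values-injective (∷-injectiveʳ eq))

values-surjective : ∀ {n m} u → length u ≡ m → All (_< n) u → Σ (Vec (Fin n) m) λ v → values v ≡ u
values-surjective []      refl []           = [] , refl
values-surjective (x ∷ u) refl (x<n ∷ u<n) with v , v↦u ← values-surjective u refl u<n =
  Fin.fromℕ< x<n ∷ v , cong₂ _∷_ (FinP.toℕ-fromℕ< x<n) v↦u

∈-values⁻ : ∀ {n m x} {v : Vec (Fin n) m} → x ∈ values v → Σ (Fin m) λ i → toℕ (lookup v i) ≡ x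
∈-values⁻ {v = _ ∷ _} (here refl) = zero , refl
∈-values⁻ {v = _ ∷ v} (there x∈) with i , eq ← ∈-values⁻ {v = v} x∈ = suc i , eq

∈-values⁺ : ∀ {n m} {v : Vec (Fin n) m} i → toℕ (lookup v i) ∈ values v
∈-values⁺ {v = _ ∷ _} zero    = here refl
∈-values⁺ {v = _ ∷ v} (suc i) = there (∈-values⁺ {v = v} i)

values-< : ∀ {n m x} {v : Vec (Fin n) m} → x ∈ values v → x < n
values-< {v = v} x∈ with i , refl ← ∈-values⁻ {v = v} x∈ = FinP.toℕ<n (lookup v i)

values-unique⁺ : ∀ {n m} (v : Vec (Fin n) m) → (∀ i j → lookup v i ≡ lookup v j → i ≡ j) → Unique (values v)
values-unique⁺ []      _   = []
values-unique⁺ (a ∷ v) inj =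
  All.tabulate (λ x∈ a≡x → let i , eq = ∈-values⁻ {v = v} x∈ in
                  FinP.0≢1+n (inj zero (suc i) (FinP.toℕ-injective (trans a≡x (sym eq)))))
  ∷ values-unique⁺ v (λ i j eq → FinP.suc-injective (inj (suc i) (suc j) eq))

values-unique⁻ : ∀ {n m} (v : Vec (Fin n) m) → Unique (values v) → ∀ i j → lookup v i ≡ lookup v j → i ≡ j
values-unique⁻ (_ ∷ v) _          zero    zero    _  = refl
values-unique⁻ (_ ∷ v) (a∉ ∷ _)   zero    (suc j) eq = ⊥-elim (All.lookup a∉ (∈-values⁺ {v = v} j) (cong toℕ eq))
values-unique⁻ (_ ∷ v) (a∉ ∷ _)   (suc i) zero    eq = ⊥-elim (All.lookup a∉ (∈-values⁺ {v = v} i) (cong toℕ (sym eq)))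
values-unique⁻ (_ ∷ v) (_ ∷ v!)   (suc i) (suc j) eq = cong suc (values-unique⁻ v v! i j eq)

private
  Subseq₂-values⁻ : ∀ {n m x y} {v : Vec (Fin n) m} → Subseq₂ x y (values v) →
    Σ (Fin m) λ i → Σ (Fin m) λ j → i Fin.< j × toℕ (lookup v i) ≡ x × toℕ (lookup v j) ≡ y
  Subseq₂-values⁻ {v = _ ∷ v} (here₂ y∈) with j , eq ← ∈-values⁻ {v = v} y∈ = zero , suc j , s≤s z≤n , refl , eq
  Subseq₂-values⁻ {v = _ ∷ v} (there₂ s) with i , j , i<j , eq₁ , eq₂ ← Subseq₂-values⁻ {v = v} s =
    suc i , suc j , s≤s i<j , eq₁ , eq₂

  Subseq₃-values⁻ : ∀ {n m x y z} {v : Vec (Fin n) m} → Subseq₃ x y z (values v) →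
    Σ (Fin m) λ i → Σ (Fin m) λ j → Σ (Fin m) λ k → i Fin.< j × j Fin.< k ×
      toℕ (lookup v i) ≡ x × toℕ (lookup v j) ≡ y × toℕ (lookup v k) ≡ z
  Subseq₃-values⁻ {v = _ ∷ v} (here₃ s) with j , k , j<k , eq₁ , eq₂ ← Subseq₂-values⁻ {v = v} s =
    zero , suc j , suc k , s≤s z≤n , s≤s j<k , refl , eq₁ , eq₂
  Subseq₃-values⁻ {v = _ ∷ v} (there₃ s) with i , j , k , i<j , j<k , eq₀ , eq₁ , eq₂ ← Subseq₃-values⁻ {v = v} s =
    suc i , suc j , suc k , s≤s i<j , s≤s j<k , eq₀ , eq₁ , eq₂

  Subseq₂-values⁺ : ∀ {n m} {v : Vec (Fin n) m} (i j : Fin m) → i Fin.< j →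
                    Subseq₂ (toℕ (lookup v i)) (toℕ (lookup v j)) (values v)
  Subseq₂-values⁺ {v = _ ∷ v} zero    (suc j) _         = here₂ (∈-values⁺ {v = v} j)
  Subseq₂-values⁺ {v = _ ∷ v} (suc i) (suc j) (s≤s i<j) = there₂ (Subseq₂-values⁺ {v = v} i j i<j)

  Subseq₃-values⁺ : ∀ {n m} {v : Vec (Fin n) m} (i j k : Fin m) → i Fin.< j → j Fin.< k →
                    Subseq₃ (toℕ (lookup v i)) (toℕ (lookup v j)) (toℕ (lookup v k)) (values v)
  Subseq₃-values⁺ {v = _ ∷ v} zero    (suc j) (suc k) _         (s≤s j<k) = here₃ (Subseq₂-values⁺ {v = v} j k j<k)
  Subseq₃-values⁺ {v = _ ∷ v} (suc i) (suc j) (suc k) (s≤s i<j) (s≤s j<k) = there₃ (Subseq₃-values⁺ {v = v} i j k i<j j<k)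

-- ContainsOmega, for vectors of any length m rather than only for words (m = n), so that it can be proved by induction.
ContainsΩ : ∀ {n m} → Vec (Fin n) m → Set
ContainsΩ {n} {m} p =
  Σ (Fin m) λ i → Σ (Fin m) λ k → Σ (Fin m) λ j →
    (toℕ k ≡ suc (toℕ i)) × (toℕ k ℕ.< toℕ j) ×
    (lookup p k Fin.< lookup p i) × (toℕ (lookup p k) ≡ suc (toℕ (lookup p j)))

HasΩ-values⁻ : ∀ {n m} (v : Vec (Fin n) m) → HasΩ (values v) → ContainsΩ v
HasΩ-values⁻ (_ ∷ [])    o = ⊥-elim (¬HasΩ-[ _ ] o)
HasΩ-values⁻ (_ ∷ _ ∷ v) (hereΩ b<a c∈)
  with c , c∈ , b≡1+c ← find c∈ with j , refl ← ∈-values⁻ {v = v} c∈ =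
  zero , suc zero , suc (suc j) , refl , s≤s (s≤s z≤n) , b<a , b≡1+c
HasΩ-values⁻ (_ ∷ b ∷ v) (thereΩ o) with i , k , j , k≡1+i , k<j , lt , eq ← HasΩ-values⁻ (b ∷ v) o =
  suc i , suc k , suc j , cong suc k≡1+i , s≤s k<j , lt , eq

HasΩ-values⁺ : ∀ {n m} (v : Vec (Fin n) m) → ContainsΩ v → HasΩ (values v)
HasΩ-values⁺ (_ ∷ _ ∷ v) (zero , suc zero , suc (suc j) , _ , _ , b<a , b≡1+c) =
  hereΩ b<a (Any.map (λ { refl → b≡1+c }) (∈-values⁺ {v = v} j))
HasΩ-values⁺ (_ ∷ _ ∷ _) (zero , suc zero , suc zero , _ , s≤s () , _)
HasΩ-values⁺ (_ ∷ _)     (zero , suc zero , zero , _ , () , _)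
HasΩ-values⁺ (_ ∷ v)     (suc i , suc k , suc j , k≡1+i , s≤s k<j , lt , eq) =
  thereΩ (HasΩ-values⁺ v (i , k , j , suc-injective k≡1+i , k<j , lt , eq))

private
  -- The right-hand comparison is between letters of a fixed pattern, so it is closed and decided by computation.
  holds : ∀ {a b c d : ℕ} → a < b → {T (suc c ℕ.≤ᵇ d)} → (a < b) ⇔ (c < d)
  holds a<b {c<d} = mk⇔ (λ _ → ≤ᵇ⇒≤ _ _ c<d) (λ _ → a<b)

  fails : ∀ {a b c d : ℕ} → b ≤ a → {T (d ℕ.≤ᵇ c)} → (a < b) ⇔ (c < d)
  fails b≤a {d≤c} = mk⇔ (λ a<b → ⊥-elim (<⇒≱ a<b b≤a)) (λ c<d → ⊥-elim (<⇒≱ c<d (≤ᵇ⇒≤ _ _ d≤c)))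

order-isomorphic-231 : (v : Fin 3 → ℕ) → v (suc (suc zero)) < v zero → v zero < v (suc zero) →
                       (s t : Fin 3) → (v s < v t) ⇔ (lookup p231 s Fin.< lookup p231 t)
order-isomorphic-231 v z<x x<y = λ where
  zero             zero             → fails ≤-refl
  zero             (suc zero)       → holds x<y
  zero             (suc (suc zero)) → fails (<⇒≤ z<x)
  (suc zero)       zero             → fails (<⇒≤ x<y)
  (suc zero)       (suc zero)       → fails ≤-refl
  (suc zero)       (suc (suc zero)) → fails (<⇒≤ (<-trans z<x x<y))
  (suc (suc zero)) zero             → holds z<x
  (suc (suc zero)) (suc zero)       → holds (<-trans z<x x<y)
  (suc (suc zero)) (suc (suc zero)) → fails ≤-refl

order-isomorphic-213 : (v : Fin 3 → ℕ) → v (suc zero) < v zero → v zero < v (suc (suc zero)) →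
                       (s t : Fin 3) → (v s < v t) ⇔ (lookup p213 s Fin.< lookup p213 t)
order-isomorphic-213 v y<x x<z = λ where
  zero             zero             → fails ≤-refl
  zero             (suc zero)       → fails (<⇒≤ y<x)
  zero             (suc (suc zero)) → holds x<z
  (suc zero)       zero             → holds y<x
  (suc zero)       (suc zero)       → fails ≤-refl
  (suc zero)       (suc (suc zero)) → holds (<-trans y<x x<z)
  (suc (suc zero)) zero             → fails (<⇒≤ x<z)
  (suc (suc zero)) (suc zero)       → fails (<⇒≤ (<-trans y<x x<z))
  (suc (suc zero)) (suc (suc zero)) → fails ≤-refl

Contains3⇔231 : ∀ {n} (p : Word n) → Contains3 p p231 ⇔ Contains Avoiding231.Pattern231 (values p)
Contains3⇔231 p = mk⇔ to from
  where
  to : Contains3 p p231 → Contains Avoiding231.Pattern231 (values p)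
  to (i₁ , i₂ , i₃ , i₁<i₂ , i₂<i₃ , order) =
    toℕ (lookup p i₁) , toℕ (lookup p i₂) , toℕ (lookup p i₃) ,
    (Equivalence.from (order (suc (suc zero)) zero) (s≤s z≤n) , Equivalence.from (order zero (suc zero)) (s≤s (s≤s z≤n))) ,
    Subseq₃-values⁺ {v = p} i₁ i₂ i₃ i₁<i₂ i₂<i₃
  from : Contains Avoiding231.Pattern231 (values p) → Contains3 p p231
  from (_ , _ , _ , (z<x , x<y) , s) with i₁ , i₂ , i₃ , i₁<i₂ , i₂<i₃ , refl , refl , refl ← Subseq₃-values⁻ {v = p} s =
    i₁ , i₂ , i₃ , i₁<i₂ , i₂<i₃ , order-isomorphic-231 _ z<x x<y

Contains3⇔213 : ∀ {n} (p : Word n) → Contains3 p p213 ⇔ Contains Avoiding213.Pattern213 (values p)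
Contains3⇔213 p = mk⇔ to from
  where
  to : Contains3 p p213 → Contains Avoiding213.Pattern213 (values p)
  to (i₁ , i₂ , i₃ , i₁<i₂ , i₂<i₃ , order) =
    toℕ (lookup p i₁) , toℕ (lookup p i₂) , toℕ (lookup p i₃) ,
    (Equivalence.from (order (suc zero) zero) (s≤s z≤n) , Equivalence.from (order zero (suc (suc zero))) (s≤s (s≤s z≤n))) ,
    Subseq₃-values⁺ {v = p} i₁ i₂ i₃ i₁<i₂ i₂<i₃
  from : Contains Avoiding213.Pattern213 (values p) → Contains3 p p213
  from (_ , _ , _ , (y<x , x<z) , s) with i₁ , i₂ , i₃ , i₁<i₂ , i₂<i₃ , refl , refl , refl ← Subseq₃-values⁻ {v = p} s =
    i₁ , i₂ , i₃ , i₁<i₂ , i₂<i₃ , order-isomorphic-213 _ y<x x<z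

length-values : ∀ {n m} (v : Vec (Fin n) m) → length (values v) ≡ m
length-values []      = refl
length-values (_ ∷ v) = cong suc (length-values v)

CountIs-filter : ∀ {A : Set} {P : A → Set} (P? : Decidable P) xs → CountIs P xs (length (filter P? xs))
CountIs-filter P? []       = c[]
CountIs-filter P? (x ∷ xs) with P? x
... | yes Px  = cyes Px  (CountIs-filter P? xs)
... | no  ¬Px = cno  ¬Px (CountIs-filter P? xs)

∈-vecs : ∀ {A : Set} {as : List A} k (v : Vec A k) → (∀ a → a ∈ as) → v ∈ vecs as k
∈-vecs zero    []      _      = here refl
∈-vecs {as = as} (suc k) (a ∷ v) ∈as =
  ∈-concatMap⁺ (λ a′ → map (a′ ∷_) (vecs as k)) {xs = as} (Any.map (λ { refl → ∈-map⁺ (a ∷_) (∈-vecs k v ∈as) }) (∈as a))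

vecs-unique : ∀ {A : Set} {as : List A} → Unique as → ∀ k → Unique (vecs as k)
vecs-unique as! zero    = [] ∷ []
vecs-unique {as = as} as! (suc k) = Unique-concatMap⁺ (λ a → map (a ∷_) (vecs as k)) as!
  (λ _ → Unique.map⁺ ∷-injectiveʳ′ (vecs-unique as! k))
  λ _ _ u∈ u∈′ → let _ , _ , eq = ∈-map⁻ _ u∈ ; _ , _ , eq′ = ∈-map⁻ _ u∈′ in ∷-injectiveˡ′ (trans (sym eq) eq′)
  where open import Data.Vec.Properties using () renaming (∷-injectiveˡ to ∷-injectiveˡ′; ∷-injectiveʳ to ∷-injectiveʳ′)

allWords-unique : ∀ n → Unique (allWords n)
allWords-unique n = vecs-unique (Unique.tabulate⁺ id) n

∈-allWords : ∀ {n} (p : Word n) → p ∈ allWords n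
∈-allWords {n} p = ∈-vecs n p ∈-tabulate⁺

module Counting (y : Pattern3) (R : ℕ → ℕ → ℕ → Set) (family : ℕ → List (List ℕ))
                (family-sound : ∀ n {u} → u ∈ family n → Avoider R n u)
                (family-complete : ∀ n {u} → Avoider R n u → u ∈ family n)
                (family-unique : ∀ n → Unique (family n))
                (Contains3⇔ : ∀ {n} (p : Word n) → Contains3 p y ⇔ Contains R (values p))
                (n : ℕ) where

  Admissible : Word n → Set
  Admissible p = IsPerm p × AvoidsOmega p × Avoids3 p y

  Admissible⇔Avoider : (p : Word n) → Admissible p ⇔ Avoider R n (values p)
  Admissible⇔Avoider p = mk⇔
    (λ (p-perm , ¬Ω , ¬y) → avoider (isRange (values-unique⁺ p p-perm) (λ x∈ → z≤n , values-< {v = p} x∈) (covers′ p-perm))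
                                    (¬Ω ∘ HasΩ-values⁻ p) (¬y ∘ Equivalence.from (Contains3⇔ p)))
    λ a → values-unique⁻ p (unique (perm a)) , avoidsΩ a ∘ HasΩ-values⁺ p , avoidsR a ∘ Equivalence.to (Contains3⇔ p)
    where
    covers′ : IsPerm p → ∀ {x} → 0 ≤ x → x < n → x ∈ values p
    covers′ p-perm _ x<n = unique-⊆-length≥⇒⊇ (values-unique⁺ p p-perm) (λ x∈ → ∈-range⁺ z≤n (values-< {v = p} x∈))
      (≤-reflexive (trans (length-applyUpTo (0 +_) n) (sym (length-values p)))) (∈-range⁺ z≤n x<n)

  Admissible? : Decidable Admissible
  Admissible? p with values p ∈ᴸ? family n
  ... | yes p∈ = yes (Equivalence.from (Admissible⇔Avoider p) (family-sound n p∈))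
  ... | no  p∉ = no (p∉ ∘ family-complete n ∘ Equivalence.to (Admissible⇔Avoider p))

  length-admissible : length (filter Admissible? (allWords n)) ≡ length (family n)
  length-admissible = begin
    length (filter Admissible? (allWords n))            ≡⟨ length-map values (filter Admissible? (allWords n)) ⟨
    length (map values (filter Admissible? (allWords n))) ≡⟨ ≤-antisym
      (unique-⊆⇒length≤ admissible! admissible⊆family) (unique-⊆⇒length≤ (family-unique n) family⊆admissible) ⟩
    length (family n)                                    ∎
    where
    open ≡-Reasoning
    admissible! : Unique (map values (filter Admissible? (allWords n)))
    admissible! = Unique.map⁺ values-injective (Unique.filter⁺ Admissible? (allWords-unique n))
    admissible⊆family : map values (filter Admissible? (allWords n)) ⊆ family n
    admissible⊆family u∈ with p , p∈ , refl ← ∈-map⁻ values u∈ =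
      family-complete n (Equivalence.to (Admissible⇔Avoider p) (proj₂ (∈-filter⁻ Admissible? {xs = allWords n} p∈)))
    family⊆admissible : family n ⊆ map values (filter Admissible? (allWords n))
    family⊆admissible {u} u∈ with a ← family-sound n u∈
      with p , refl ← values-surjective u (IsRange-length (perm a)) (All.tabulate (proj₂ ∘ bounded (perm a))) =
      ∈-map⁺ values (∈-filter⁺ Admissible? (∈-allWords p) (Equivalence.from (Admissible⇔Avoider p) a))

  count : CountIs Admissible (allWords n) (length (family n))
  count = subst (CountIs Admissible (allWords n)) length-admissible (CountIs-filter Admissible? (allWords n))

proposition5p6 : (y : Pattern3) → (y ≡ p213 ⊎ y ≡ p231) → (n : ℕ) →
    CountIs (λ p → IsPerm p × AvoidsOmega p × Avoids3 p y) (allWords n) (motzkin n)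
proposition5p6 _ (inj₁ refl) n = subst (CountIs _ (allWords n)) (length-family n)
  (Counting.count p213 Pattern213 family family-sound family-complete family-unique Contains3⇔213 n)
  where open Avoiding213
proposition5p6 _ (inj₂ refl) n = subst (CountIs _ (allWords n)) (length-family n)
  (Counting.count p231 Pattern231 family family-sound family-complete family-unique Contains3⇔231 n)
  where open Avoiding231
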